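{- Let $1\le i_1\le j_1\le n$. The number ${}^{i_1,j_1}S_n$ of fully commutative elements of $W(A_n)$ whose canonical form has first block $[i_1,j_1]$ is $${}^{i_1,j_1}S_n=\frac{j_1-i_1+2}{j_1+1}\binom{j_1+i_1-1}{j_1},$$ and, for $1\le i_p\le j_p\le n$, the number $S_n^{i_p,j_p}$ of FC elements whose canonical form has last block $[i_p,j_p]$ is $$S_n^{i_p,j_p}=\frac{j_p-i_p+2}{n-i_p+2}\binom{2n-j_p-i_p+1}{n-j_p}.$$
   Context: $W(A_n)$: Coxeter group with generators $\sigma_1,\dots,\sigma_n$ of type $A_n$. FC = fully commutative (reduced expressions related by commutations only). $[i,j]=\sigma_i\cdots\sigma_j$; every FC element $\neq 1$ has a unique canonical form $[i_1,j_1]\cdots[i_p,j_p]$ with $p\ge1$, $n\ge j_1>\cdots>j_p\ge1$, $n\ge i_1>\cdots>i_p\ge1$, $j_t\ge i_t$; its first block is $[i_1,j_1]$ and last block $[i_p,j_p]$. -}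

module Defs where

open import Data.Nat using (ℕ; zero; suc; _+_; _*_; _∸_; _≤_; _<_)
open import Data.List using (List; []; _∷_; _++_; length; foldl; upTo; map; concat; _∷ʳ_)
open import Data.List.Relation.Unary.All using (All)
open import Data.List.Relation.Unary.Unique.Propositional using (Unique)
open import Data.List.Membership.Propositional using (_∈_)
open import Data.Product using (Σ; ∃; ∃-syntax; _×_; _,_)
open import Data.Sum using (_⊎_)
open import Data.Unit using (⊤)
open import Relation.Binary.PropositionalEquality using (_≡_)
open import Relation.Binary.Construct.Closure.ReflexiveTransitive using (Star)

-- W(A_n) realised as the symmetric group S_{n+1} acting on {0,…,n};
-- elements are represented in one-line notation (a List ℕ), and the
-- Coxeter generator σ_k (1 ≤ k ≤ n) is the adjacent transposition
-- exchanging positions k and k+1 (1-indexed).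

-- right multiplication by σ_k : swap the entries in positions k, k+1
swapAt : ℕ → List ℕ → List ℕ
swapAt 1 (x ∷ y ∷ xs) = y ∷ x ∷ xs
swapAt (suc (suc k)) (x ∷ xs) = x ∷ swapAt (suc k) xs
swapAt _ xs = xs

idPerm : ℕ → List ℕ
idPerm n = upTo (suc n)

ValidWord : ℕ → List ℕ → Set
ValidWord n w = All (λ k → 1 ≤ k × k ≤ n) w

eval : ℕ → List ℕ → List ℕ
eval n w = foldl (λ p k → swapAt k p) (idPerm n) w

IsElem : ℕ → List ℕ → Set
IsElem n p = ∃[ w ] (ValidWord n w × eval n w ≡ p)

Reduced : ℕ → List ℕ → List ℕ → Set
Reduced n w p = ValidWord n w × eval n w ≡ p ×
  (∀ v → ValidWord n v → eval n v ≡ p → length w ≤ length v)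

Distant : ℕ → ℕ → Set
Distant a b = suc a < b ⊎ suc b < a

data CommStep : List ℕ → List ℕ → Set where
  comm : ∀ u v a b → Distant a b → CommStep (u ++ a ∷ b ∷ v) (u ++ b ∷ a ∷ v)

_~c_ : List ℕ → List ℕ → Set
u ~c v = Star CommStep u v

IsFC : ℕ → List ℕ → Set
IsFC n p = IsElem n p × (∀ u v → Reduced n u p → Reduced n v p → u ~c v)

block : ℕ → ℕ → List ℕ
block i j = map (i +_) (upTo (suc (j ∸ i)))

blocksWord : List (ℕ × ℕ) → List ℕ
blocksWord bs = concat (map (λ { (i , j) → block i j }) bs)

BlockOK : ℕ → ℕ × ℕ → Set
BlockOK n (i , j) = 1 ≤ i × i ≤ j × j ≤ n

Decreasing : List (ℕ × ℕ) → Set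
Decreasing [] = ⊤
Decreasing (_ ∷ []) = ⊤
Decreasing ((i , j) ∷ (i' , j') ∷ bs) = i' < i × j' < j × Decreasing ((i' , j') ∷ bs)

IsCanonicalForm : ℕ → List (ℕ × ℕ) → List ℕ → Set
IsCanonicalForm n bs p =
  (∃[ b ] ∃[ bs' ] bs ≡ b ∷ bs') × All (BlockOK n) bs × Decreasing bs × eval n (blocksWord bs) ≡ p

FCFirstBlock : ℕ → ℕ → ℕ → List ℕ → Set
FCFirstBlock n i j p = IsFC n p × ∃[ rest ] IsCanonicalForm n ((i , j) ∷ rest) p

FCLastBlock : ℕ → ℕ → ℕ → List ℕ → Set
FCLastBlock n i j p = IsFC n p × ∃[ rest ] IsCanonicalForm n (rest ∷ʳ (i , j)) p

HasCount : (List ℕ → Set) → ℕ → Set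
HasCount P N = Σ (List (List ℕ)) λ L →
  Unique L × (∀ p → (p ∈ L → P p) × (P p → p ∈ L)) × length L ≡ N

-- Acting on one-line notation, W(A_n) is the symmetric group on {0, …, n} and the length of a
-- permutation is its number of inversions; a word is reduced iff its length is that number.
-- A 321-avoiding permutation is fully commutative: the last letters a, b of two reduced words
-- are descents of p, 321-avoidance forbids |a − b| = 1, and induction on the length relates the
-- words by commutations (through a common reduced word of p σ_a σ_b when a, b are distant).
-- Applied to the identity, a canonical word [i₁,j₁]⋯[i_p,j_p] stays 321-avoiding, since each block
-- rotates an entry past an increasing run to its right, and it determines its blocks, since the
-- entry moved by [i₁,j₁] lands in position j₁ + 1 and is never moved again. So FC elements with
-- first block [i,j] correspond to chains of blocks below (i , j), counted by the ballot numbers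
-- (a + b) C b − (a + b) C (b + 1); the count by last block reduces to the same numbers by
-- reflecting blocks (i , j) ↦ (n + 1 − j , n + 1 − i).

module Submission where

open import Defs
open import Data.Nat
open import Data.Nat.Properties
open import Data.Nat.Combinatorics using (_C_; nCk+nC[k+1]≡[n+1]C[k+1]; nCk≡nC[n∸k]; nCn≡1; nC1≡n; k>n⇒nCk≡0)
open import Data.Nat.ListAction using (sum)
open import Data.Nat.ListAction.Properties using (sum-++)
open import Data.Nat.Tactic.RingSolver using (solve-∀)
open import Data.List using (List; []; _∷_; _++_; _∷ʳ_; length; map; foldl; filter; concatMap; applyUpTo; initLast; _∷ʳ′_)
open import Data.List.Properties
  using (length-++; length-map; length-applyUpTo; ++-assoc; ++-identityʳ; ∷-injective; ∷-injectiveˡ; ∷-injectiveʳ;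
         ∷ʳ-injectiveˡ; ∷ʳ-injectiveʳ; map-cong; map-++; map-∘; map-applyUpTo; foldl-++; foldl-∷ʳ;
         filter-accept; filter-reject; filter-none)
open import Data.List.Relation.Unary.All as All using (All; []; _∷_)
open import Data.List.Relation.Unary.All.Properties using (++⁻; ++⁻ˡ; ++⁻ʳ) renaming (++⁺ to All++⁺)
open import Data.List.Relation.Unary.AllPairs using (AllPairs; []; _∷_)
open import Data.List.Relation.Unary.Any using (here; there)
open import Data.List.Relation.Unary.Unique.Propositional using (Unique)
open import Data.List.Relation.Unary.Unique.Propositional.Properties using (upTo⁺) renaming (++⁺ to Unique-++⁺; map⁺ to Unique-map⁺)
open import Data.List.Relation.Unary.Sorted.TotalOrder.Properties using (↗↭↗⇒≋; AllPairs⇒Sorted)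
open import Data.List.Relation.Binary.Pointwise using (Pointwise-≡⇒≡)
open import Data.List.Relation.Binary.Permutation.Propositional using (_↭_; prep; swap; ↭-refl; ↭-sym; ↭-trans; ↭⇒↭ₛ)
open import Data.List.Relation.Binary.Permutation.Propositional.Properties
  using (↭-length; filter-↭; All-resp-↭; ++⁺ˡ; shift)
import Data.List.Relation.Binary.Permutation.Setoid.Properties as Perm≡
open import Data.List.Membership.Propositional using (_∈_; find; lose)
open import Data.List.Membership.Propositional.Properties
  using (∈-map⁺; ∈-map⁻; ∈-++⁺ˡ; ∈-++⁺ʳ; ∈-++⁻; ∈-concatMap⁺; ∈-concatMap⁻)
open import Data.Product using (∃-syntax; _×_; _,_; proj₁; proj₂)
open import Data.Sum using (_⊎_; inj₁; inj₂)
open import Data.Empty using (⊥; ⊥-elim)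
open import Data.Unit using (⊤; tt)
open import Relation.Nullary using (¬_; yes; no)
open import Relation.Binary using (tri<; tri≈; tri>)
open import Relation.Binary.PropositionalEquality
open import Relation.Binary.Construct.Closure.ReflexiveTransitive as Star using (ε; _◅_; _◅◅_)

act : List ℕ → ℕ → List ℕ
act p k = swapAt k p

applyWord : List ℕ → List ℕ → List ℕ
applyWord = foldl act

swapAt-↭ : ∀ k xs → swapAt k xs ↭ xs
swapAt-↭ zero xs = ↭-refl
swapAt-↭ (suc zero) [] = ↭-refl
swapAt-↭ (suc zero) (x ∷ []) = ↭-refl
swapAt-↭ (suc zero) (x ∷ y ∷ xs) = swap y x ↭-refl
swapAt-↭ (suc (suc k)) [] = ↭-refl
swapAt-↭ (suc (suc k)) (x ∷ xs) = prep x (swapAt-↭ (suc k) xs)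

applyWord-↭ : ∀ q w → applyWord q w ↭ q
applyWord-↭ q [] = ↭-refl
applyWord-↭ q (k ∷ w) = ↭-trans (applyWord-↭ (swapAt k q) w) (swapAt-↭ k q)

swapAt-involutive : ∀ k xs → swapAt k (swapAt k xs) ≡ xs
swapAt-involutive zero xs = refl
swapAt-involutive (suc zero) [] = refl
swapAt-involutive (suc zero) (x ∷ []) = refl
swapAt-involutive (suc zero) (x ∷ y ∷ xs) = refl
swapAt-involutive (suc (suc k)) [] = refl
swapAt-involutive (suc (suc k)) (x ∷ xs) = cong (x ∷_) (swapAt-involutive (suc k) xs)

eval-∷ʳ : ∀ n w k → eval n (w ∷ʳ k) ≡ swapAt k (eval n w)
eval-∷ʳ n w k = foldl-∷ʳ act (idPerm n) k w

length-∷ʳ : ∀ (w : List ℕ) k → length (w ∷ʳ k) ≡ suc (length w)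
length-∷ʳ w k = trans (length-++ w) (+-comm (length w) 1)

range : ℕ → ℕ → List ℕ
range lo zero = []
range lo (suc k) = lo ∷ range (suc lo) k

applyUpTo≡range : ∀ {f : ℕ → ℕ} a m → (∀ t → f t ≡ a + t) → applyUpTo f m ≡ range a m
applyUpTo≡range a zero e = refl
applyUpTo≡range a (suc m) e =
  cong₂ _∷_ (trans (e 0) (+-identityʳ a)) (applyUpTo≡range (suc a) m (λ t → trans (e (suc t)) (+-suc a t)))

idPerm≡range : ∀ n → idPerm n ≡ range 0 (suc n)
idPerm≡range n = applyUpTo≡range 0 (suc n) (λ _ → refl)

block≡range : ∀ i j → block i j ≡ range i (suc (j ∸ i))
block≡range i j = trans (map-applyUpTo (λ t → t) (i +_) (suc (j ∸ i))) (applyUpTo≡range i _ (λ _ → refl))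

All-range : ∀ {P : ℕ → Set} b m → (∀ x → b ≤ x → x < b + m → P x) → All P (range b m)
All-range b zero h = []
All-range b (suc m) h = h b ≤-refl (subst (b <_) (sym (+-suc b m)) (s≤s (m≤m+n b m)))
  ∷ All-range (suc b) m (λ x p q → h x (<⇒≤ p) (subst (x <_) (sym (+-suc b m)) q))

Sorted : List ℕ → Set
Sorted = AllPairs _≤_

range-sorted : ∀ b m → Sorted (range b m)
range-sorted b zero = []
range-sorted b (suc m) = All-range (suc b) m (λ x p _ → <⇒≤ p) ∷ range-sorted (suc b) m

idPerm-sorted : ∀ n → Sorted (idPerm n)
idPerm-sorted n = subst Sorted (sym (idPerm≡range n)) (range-sorted 0 (suc n))

smallerThan : ℕ → List ℕ → ℕ
smallerThan x ys = length (filter (_<? x) ys)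

inversions : List ℕ → ℕ
inversions [] = 0
inversions (x ∷ xs) = smallerThan x xs + inversions xs

smallerThan-↭ : ∀ z {xs ys} → xs ↭ ys → smallerThan z xs ≡ smallerThan z ys
smallerThan-↭ z p = ↭-length (filter-↭ (_<? z) p)

sorted⇒inversions≡0 : ∀ {q} → Sorted q → inversions q ≡ 0
sorted⇒inversions≡0 [] = refl
sorted⇒inversions≡0 {x ∷ xs} (x≤xs ∷ s) =
  cong₂ _+_ (cong length (filter-none (_<? x) (All.map ≤⇒≯ x≤xs))) (sorted⇒inversions≡0 s)

data Descent : ℕ → List ℕ → Set where
  here  : ∀ {x y r} → y < x → Descent 1 (x ∷ y ∷ r)
  there : ∀ {k z r} → Descent (suc k) r → Descent (suc (suc k)) (z ∷ r)

∷-descent : ∀ {k z r} → Descent k r → Descent (suc k) (z ∷ r)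
∷-descent (here p) = there (here p)
∷-descent (there d) = there (there d)

descent-bounds : ∀ {k q} → Descent k q → 1 ≤ k × suc k ≤ length q
descent-bounds (here _) = s≤s z≤n , s≤s (s≤s z≤n)
descent-bounds (there d) = s≤s z≤n , s≤s (proj₂ (descent-bounds d))

inversions-descent : ∀ {k q} → Descent k q → suc (inversions (swapAt k q)) ≡ inversions q
inversions-descent (here {x} {y} {r} y<x) = begin
  suc (smallerThan y (x ∷ r) + (smallerThan x r + inversions r))
    ≡⟨ cong (λ a → suc (a + (smallerThan x r + inversions r))) (cong length (filter-reject (_<? y) (<⇒≯ y<x))) ⟩
  suc (smallerThan y r + (smallerThan x r + inversions r))
    ≡⟨ exchange (smallerThan y r) (smallerThan x r) (inversions r) ⟩
  suc (smallerThan x r) + (smallerThan y r + inversions r)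
    ≡⟨ cong (_+ (smallerThan y r + inversions r)) (cong length (filter-accept (_<? x) y<x)) ⟨
  smallerThan x (y ∷ r) + (smallerThan y r + inversions r) ∎
  where
  open ≡-Reasoning
  exchange : ∀ a b c → suc (a + (b + c)) ≡ suc b + (a + c)
  exchange = solve-∀
inversions-descent (there {k} {z} {r} d) =
  trans (sym (+-suc (smallerThan z (swapAt (suc k) r)) _))
    (cong₂ _+_ (smallerThan-↭ z (swapAt-↭ (suc k) r)) (inversions-descent d))

inversions-ascent : ∀ {k q} → Descent k (swapAt k q) → inversions (swapAt k q) ≡ suc (inversions q)
inversions-ascent {k} {q} d =
  trans (sym (inversions-descent d)) (cong (λ t → suc (inversions t)) (swapAt-involutive k q))

-- The third case only happens when the two entries are equal or k is out of range.
descent-trichotomy : ∀ k q → Descent k (swapAt k q) ⊎ Descent k q ⊎ swapAt k q ≡ q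
descent-trichotomy zero q = inj₂ (inj₂ refl)
descent-trichotomy (suc zero) [] = inj₂ (inj₂ refl)
descent-trichotomy (suc zero) (x ∷ []) = inj₂ (inj₂ refl)
descent-trichotomy (suc zero) (x ∷ y ∷ r) with <-cmp x y
... | tri< x<y _ _ = inj₁ (here x<y)
... | tri≈ _ refl _ = inj₂ (inj₂ refl)
... | tri> _ _ y<x = inj₂ (inj₁ (here y<x))
descent-trichotomy (suc (suc k)) [] = inj₂ (inj₂ refl)
descent-trichotomy (suc (suc k)) (z ∷ r) with descent-trichotomy (suc k) r
... | inj₁ d = inj₁ (there d)
... | inj₂ (inj₁ d) = inj₂ (inj₁ (there d))
... | inj₂ (inj₂ e) = inj₂ (inj₂ (cong (z ∷_) e))

inversions-swapAt-≤ : ∀ k q → inversions (swapAt k q) ≤ suc (inversions q)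
inversions-swapAt-≤ k q with descent-trichotomy k q
... | inj₁ d = ≤-reflexive (inversions-ascent d)
... | inj₂ (inj₁ d) = m≤n⇒m≤1+n (≤-trans (n≤1+n _) (≤-reflexive (inversions-descent d)))
... | inj₂ (inj₂ e) = m≤n⇒m≤1+n (≤-reflexive (cong inversions e))

inversions-applyWord-≤ : ∀ w q → inversions (applyWord q w) ≤ inversions q + length w
inversions-applyWord-≤ [] q = ≤-reflexive (sym (+-identityʳ _))
inversions-applyWord-≤ (k ∷ w) q = begin
  inversions (applyWord (swapAt k q) w) ≤⟨ inversions-applyWord-≤ w (swapAt k q) ⟩
  inversions (swapAt k q) + length w    ≤⟨ +-monoˡ-≤ (length w) (inversions-swapAt-≤ k q) ⟩
  suc (inversions q) + length w         ≡⟨ +-suc (inversions q) (length w) ⟨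
  inversions q + length (k ∷ w)         ∎
  where open ≤-Reasoning

inversions-eval-≤ : ∀ n w → inversions (eval n w) ≤ length w
inversions-eval-≤ n w = subst (λ t → inversions (eval n w) ≤ t + length w)
  (sorted⇒inversions≡0 (idPerm-sorted n)) (inversions-applyWord-≤ w (idPerm n))

IsPerm : ℕ → List ℕ → Set
IsPerm n q = q ↭ idPerm n

isPerm-length : ∀ {n q} → IsPerm n q → length q ≡ suc n
isPerm-length {n} p = trans (↭-length p) (length-applyUpTo (λ t → t) (suc n))

isPerm-swapAt : ∀ {n q} k → IsPerm n q → IsPerm n (swapAt k q)
isPerm-swapAt {q = q} k p = ↭-trans (swapAt-↭ k q) p

isPerm-eval : ∀ n w → IsPerm n (eval n w)
isPerm-eval n w = applyWord-↭ (idPerm n) w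

sorted-isPerm⇒idPerm : ∀ {n q} → IsPerm n q → Sorted q → q ≡ idPerm n
sorted-isPerm⇒idPerm {n} p s = Pointwise-≡⇒≡
  (↗↭↗⇒≋ ≤-totalOrder (AllPairs⇒Sorted ≤-totalOrder s) (AllPairs⇒Sorted ≤-totalOrder (idPerm-sorted n)) (↭⇒↭ₛ p))

descent-or-sorted : ∀ q → (∃[ k ] Descent k q) ⊎ Sorted q
descent-or-sorted [] = inj₂ []
descent-or-sorted (x ∷ []) = inj₂ ([] ∷ [])
descent-or-sorted (x ∷ y ∷ r) with descent-or-sorted (y ∷ r)
... | inj₁ (k , d) = inj₁ (suc k , ∷-descent d)
... | inj₂ (y≤r ∷ s) with y <? x
...   | yes y<x = inj₁ (1 , here y<x)
...   | no y≮x = inj₂ ((x≤y ∷ All.map (≤-trans x≤y) y≤r) ∷ y≤r ∷ s)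
  where
  x≤y : x ≤ y
  x≤y = ≮⇒≥ y≮x

descent-valid : ∀ {n k q} → IsPerm n q → Descent k q → 1 ≤ k × k ≤ n
descent-valid p d with descent-bounds d
... | 1≤k , k<len = 1≤k , ≤-pred (subst (_ ≤_) (isPerm-length p) k<len)

reducedWord : ∀ n q → IsPerm n q → ∃[ w ] (ValidWord n w × eval n w ≡ q × length w ≡ inversions q)
reducedWord n q p = go (inversions q) q p refl
  where
  go : ∀ m q → IsPerm n q → inversions q ≡ m →
    ∃[ w ] (ValidWord n w × eval n w ≡ q × length w ≡ inversions q)
  go zero q p e with descent-or-sorted q
  ... | inj₁ (k , d) with () ← trans (inversions-descent d) e
  ... | inj₂ s = [] , [] , sym (sorted-isPerm⇒idPerm p s) , sym e
  go (suc m) q p e with descent-or-sorted q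
  ... | inj₂ s with () ← trans (sym (sorted⇒inversions≡0 s)) e
  ... | inj₁ (k , d)
    with w , vw , ew , lw ← go m (swapAt k q) (isPerm-swapAt k p) (suc-injective (trans (inversions-descent d) e)) =
    w ∷ʳ k ,
    All++⁺ vw (descent-valid p d ∷ []) ,
    trans (eval-∷ʳ n w k) (trans (cong (swapAt k) ew) (swapAt-involutive k q)) ,
    trans (length-∷ʳ w k) (trans (cong suc lw) (inversions-descent d))

reduced⇒length≡inversions : ∀ {n w p} → Reduced n w p → length w ≡ inversions p
reduced⇒length≡inversions {n} {w} (vw , refl , minimal)
  with v , vv , ev , lv ← reducedWord n (eval n w) (isPerm-eval n w) =
  ≤-antisym (≤-trans (minimal v vv ev) (≤-reflexive lv)) (inversions-eval-≤ n w)

length≡inversions⇒reduced : ∀ {n w p} → ValidWord n w → eval n w ≡ p → length w ≡ inversions p → Reduced n w p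
length≡inversions⇒reduced {n} {w} vw ew lw = vw , ew , λ v vv ev →
  ≤-trans (≤-reflexive lw) (subst (λ t → inversions t ≤ length v) ev (inversions-eval-≤ n v))

inversions-drop⇒descent : ∀ k q → inversions (swapAt k q) < inversions q → Descent k q
inversions-drop⇒descent k q lt with descent-trichotomy k q
... | inj₁ a = ⊥-elim (<-asym lt (subst (inversions q <_) (sym (inversions-ascent a)) (n<1+n _)))
... | inj₂ (inj₁ d) = d
... | inj₂ (inj₂ e) = ⊥-elim (<-irrefl (cong inversions e) lt)

-- 321-avoiding permutations are fully commutative

-- No21Below x ys: ys contains no y before z with z < y < x.
No21Below : ℕ → List ℕ → Set
No21Below x [] = ⊤
No21Below x (y ∷ ys) = (y < x → All (y ≤_) ys) × No21Below x ys

Avoids321 : List ℕ → Set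
Avoids321 [] = ⊤
Avoids321 (x ∷ xs) = No21Below x xs × Avoids321 xs

no21Below-swapAt : ∀ {k r} z → Descent k r → No21Below z r → No21Below z (swapAt k r)
no21Below-swapAt z (here y<x) (x-ok , y-ok , rest) =
  (λ y<z → <⇒≤ y<x ∷ y-ok y<z) ,
  (λ x<z → ⊥-elim (<⇒≱ y<x (All.head (x-ok x<z)))) , rest
no21Below-swapAt {suc (suc k)} z (there {r = r} d) (w-ok , rest) =
  (λ w<z → All-resp-↭ (↭-sym (swapAt-↭ (suc k) r)) (w-ok w<z)) , no21Below-swapAt z d rest

avoids321-swapAt : ∀ {k q} → Descent k q → Avoids321 q → Avoids321 (swapAt k q)
avoids321-swapAt (here y<x) ((_ , x-rest) , (y-rest , a)) =
  ((λ x<y → ⊥-elim (<-asym x<y y<x)) , y-rest) , (x-rest , a)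
avoids321-swapAt (there {z = z} d) (z-ok , a) = no21Below-swapAt z d z-ok , avoids321-swapAt d a

avoids321⇒¬adjacentDescents : ∀ {k q} → Avoids321 q → Descent k q → Descent (suc k) q → ⊥
avoids321⇒¬adjacentDescents ((x-ok , _) , _) (here y<x) (there (here z<y)) = <⇒≱ z<y (All.head (x-ok y<x))
avoids321⇒¬adjacentDescents (_ , a) (there d) (there d') = avoids321⇒¬adjacentDescents a d d'

distant-sym : ∀ {a b} → Distant a b → Distant b a
distant-sym (inj₁ p) = inj₂ p
distant-sym (inj₂ p) = inj₁ p

swapAt-comm-< : ∀ a b q → suc a < b → swapAt a (swapAt b q) ≡ swapAt b (swapAt a q)
swapAt-comm-< zero b q _ = refl
swapAt-comm-< (suc zero) (suc (suc zero)) q (s≤s (s≤s ()))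
swapAt-comm-< (suc zero) (suc (suc (suc b))) [] _ = refl
swapAt-comm-< (suc zero) (suc (suc (suc b))) (x ∷ []) _ = refl
swapAt-comm-< (suc zero) (suc (suc (suc b))) (x ∷ y ∷ r) _ = refl
swapAt-comm-< (suc (suc a)) (suc zero) q (s≤s ())
swapAt-comm-< (suc (suc a)) (suc (suc b)) [] _ = refl
swapAt-comm-< (suc (suc a)) (suc (suc b)) (z ∷ r) p = cong (z ∷_) (swapAt-comm-< (suc a) (suc b) r (≤-pred p))

swapAt-comm : ∀ {a b} q → Distant a b → swapAt a (swapAt b q) ≡ swapAt b (swapAt a q)
swapAt-comm {a} {b} q (inj₁ p) = swapAt-comm-< a b q p
swapAt-comm {a} {b} q (inj₂ p) = sym (swapAt-comm-< b a q p)

descent-swapAt-above : ∀ a b q → suc a < b → Descent b q → Descent b (swapAt a q)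
descent-swapAt-above zero b q _ d = d
descent-swapAt-above (suc zero) (suc (suc zero)) q (s≤s (s≤s ())) d
descent-swapAt-above (suc zero) (suc (suc (suc b))) (x ∷ y ∷ r) _ (there (there d)) = there (there d)
descent-swapAt-above (suc (suc a)) (suc zero) q (s≤s ()) d
descent-swapAt-above (suc (suc a)) (suc (suc b)) (z ∷ r) p (there d) =
  there (descent-swapAt-above (suc a) (suc b) r (≤-pred p) d)

descent-swapAt-below : ∀ a b q → suc b < a → Descent b q → Descent b (swapAt a q)
descent-swapAt-below (suc (suc zero)) (suc zero) q (s≤s (s≤s ())) d
descent-swapAt-below (suc (suc (suc a))) (suc zero) (x ∷ y ∷ r) _ (here l) = here l
descent-swapAt-below (suc zero) (suc (suc b)) q (s≤s ()) d
descent-swapAt-below (suc (suc a)) (suc (suc b)) (z ∷ r) p (there d) =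
  there (descent-swapAt-below (suc a) (suc b) r (≤-pred p) d)

descent-swapAt-distant : ∀ {a b q} → Distant a b → Descent b q → Descent b (swapAt a q)
descent-swapAt-distant {a} {b} {q} (inj₁ p) = descent-swapAt-above a b q p
descent-swapAt-distant {a} {b} {q} (inj₂ p) = descent-swapAt-below a b q p

letters-equal-adjacent-or-distant : ∀ a b → a ≡ b ⊎ suc a ≡ b ⊎ suc b ≡ a ⊎ Distant a b
letters-equal-adjacent-or-distant a b with <-cmp a b
... | tri≈ _ e _ = inj₁ e
... | tri< l _ _ with m≤n⇒m<n∨m≡n l
...   | inj₁ l' = inj₂ (inj₂ (inj₂ (inj₁ l')))
...   | inj₂ e = inj₂ (inj₁ e)
letters-equal-adjacent-or-distant a b | tri> _ _ l with m≤n⇒m<n∨m≡n l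
...   | inj₁ l' = inj₂ (inj₂ (inj₂ (inj₂ l')))
...   | inj₂ e = inj₂ (inj₂ (inj₁ e))

~c-sym : ∀ {x y} → x ~c y → y ~c x
~c-sym = Star.reverse λ { (comm u v a b d) → comm u v b a (distant-sym d) }

~c-∷ʳ : ∀ c {x y} → x ~c y → (x ∷ʳ c) ~c (y ∷ʳ c)
~c-∷ʳ c = Star.gmap (_∷ʳ c) λ { (comm u v a b d) →
  subst₂ CommStep (sym (++-assoc u (a ∷ b ∷ v) (c ∷ []))) (sym (++-assoc u (b ∷ a ∷ v) (c ∷ [])))
    (comm u (v ++ c ∷ []) a b d) }

~c-swapLast : ∀ x a b → Distant b a → ((x ∷ʳ b) ∷ʳ a) ~c ((x ∷ʳ a) ∷ʳ b)
~c-swapLast x a b d =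
  subst₂ CommStep (sym (++-assoc x (b ∷ []) (a ∷ []))) (sym (++-assoc x (a ∷ []) (b ∷ [])))
    (comm x [] b a d) ◅ ε

reduced-∷ʳ⁻ : ∀ {n m p} w a → Reduced n (w ∷ʳ a) p → inversions p ≡ suc m →
  Descent a p × Reduced n w (swapAt a p) × inversions (swapAt a p) ≡ m × (1 ≤ a × a ≤ n)
reduced-∷ʳ⁻ {n} {m} {p} w a red ip = d , length≡inversions⇒reduced vw ew (trans lw (sym ie)) , ie , va
  where
  vw : ValidWord n w
  vw = ++⁻ˡ w (proj₁ red)
  va : 1 ≤ a × a ≤ n
  va = All.head (++⁻ʳ w (proj₁ red))
  ew : eval n w ≡ swapAt a p
  ew = trans (sym (swapAt-involutive a (eval n w)))
    (cong (swapAt a) (trans (sym (eval-∷ʳ n w a)) (proj₁ (proj₂ red))))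
  lw : length w ≡ m
  lw = suc-injective (trans (sym (length-∷ʳ w a)) (trans (reduced⇒length≡inversions red) ip))
  d : Descent a p
  d = inversions-drop⇒descent a p (subst (_< inversions p) (cong inversions ew)
        (≤-<-trans (subst (inversions (eval n w) ≤_) lw (inversions-eval-≤ n w)) (≤-reflexive (sym ip))))
  ie : inversions (swapAt a p) ≡ m
  ie = suc-injective (trans (inversions-descent d) ip)

-- Induction on the length: two reduced words of p end in letters a, b at descents of p.
-- If a = b we recurse on w σ_a = p σ_a; adjacent letters are excluded by 321-avoidance;
-- if a, b are distant, both words are related to  x σ_b σ_a ~ x σ_a σ_b  for a reduced word x of p σ_a σ_b.
avoids321⇒fullyCommutative : ∀ n m p → inversions p ≡ m → Avoids321 p → IsPerm n p →
  ∀ u v → Reduced n u p → Reduced n v p → u ~c v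
avoids321⇒fullyCommutative n zero p ip av pp u v ru rv
  with [] ← u | [] ← v | refl ← trans (reduced⇒length≡inversions ru) ip | refl ← trans (reduced⇒length≡inversions rv) ip = ε
avoids321⇒fullyCommutative n (suc m) p ip av pp u v ru rv with initLast u | initLast v
... | [] | _ with () ← trans (reduced⇒length≡inversions ru) ip
... | _ ∷ʳ′ _ | [] with () ← trans (reduced⇒length≡inversions rv) ip
... | u' ∷ʳ′ a | v' ∷ʳ′ b
  with da , ru' , ia , va ← reduced-∷ʳ⁻ u' a ru ip | db , rv' , ib , vb ← reduced-∷ʳ⁻ v' b rv ip
  with letters-equal-adjacent-or-distant a b
... | inj₁ refl =
  ~c-∷ʳ a (avoids321⇒fullyCommutative n m (swapAt a p) ia (avoids321-swapAt da av) (isPerm-swapAt a pp) u' v' ru' rv')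
... | inj₂ (inj₁ refl) = ⊥-elim (avoids321⇒¬adjacentDescents av da db)
... | inj₂ (inj₂ (inj₁ refl)) = ⊥-elim (avoids321⇒¬adjacentDescents av db da)
... | inj₂ (inj₂ (inj₂ dist)) with x , vx , ex , lx ← reducedWord n (swapAt b (swapAt a p)) (isPerm-swapAt b (isPerm-swapAt a pp)) =
  ~c-∷ʳ a (IH a da ia u' (x ∷ʳ b) ru' xb-reduced) ◅◅
  ~c-swapLast x a b (distant-sym dist) ◅◅
  ~c-sym (~c-∷ʳ b (IH b db ib v' (x ∷ʳ a) rv' xa-reduced))
  where
  IH : ∀ c → Descent c p → inversions (swapAt c p) ≡ m →
    ∀ u v → Reduced n u (swapAt c p) → Reduced n v (swapAt c p) → u ~c v
  IH c dc ic = avoids321⇒fullyCommutative n m (swapAt c p) ic (avoids321-swapAt dc av) (isPerm-swapAt c pp)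
  commuted : swapAt a (swapAt b p) ≡ swapAt b (swapAt a p)
  commuted = swapAt-comm p dist
  xb-reduced : Reduced n (x ∷ʳ b) (swapAt a p)
  xb-reduced = length≡inversions⇒reduced (All++⁺ vx (vb ∷ []))
    (trans (eval-∷ʳ n x b) (trans (cong (swapAt b) ex) (swapAt-involutive b _)))
    (trans (length-∷ʳ x b) (trans (cong suc lx) (inversions-descent (descent-swapAt-distant dist db))))
  xa-reduced : Reduced n (x ∷ʳ a) (swapAt b p)
  xa-reduced = length≡inversions⇒reduced (All++⁺ vx (va ∷ []))
    (trans (eval-∷ʳ n x a) (trans (cong (swapAt a) (trans ex (sym commuted))) (swapAt-involutive a _)))
    (trans (length-∷ʳ x a) (trans (cong suc (trans lx (cong inversions (sym commuted))))
      (inversions-descent (descent-swapAt-distant (distant-sym dist) da))))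

swapAt-middle : ∀ A (x y : ℕ) r → swapAt (suc (length A)) (A ++ x ∷ y ∷ r) ≡ A ++ y ∷ x ∷ r
swapAt-middle [] x y r = refl
swapAt-middle (a ∷ A) x y r = cong (a ∷_) (swapAt-middle A x y r)

applyWord-range-rotates : ∀ M A (x : ℕ) R →
  applyWord (A ++ x ∷ M ++ R) (range (suc (length A)) (length M)) ≡ A ++ M ++ x ∷ R
applyWord-range-rotates [] A x R = refl
applyWord-range-rotates (m ∷ M) A x R = begin
  applyWord (swapAt (suc (length A)) (A ++ x ∷ m ∷ M ++ R)) (range (suc (suc (length A))) (length M))
    ≡⟨ cong (λ t → applyWord t (range (suc (suc (length A))) (length M))) (swapAt-middle A x m (M ++ R)) ⟩
  applyWord (A ++ m ∷ x ∷ M ++ R) (range (suc (suc (length A))) (length M))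
    ≡⟨ cong₂ (λ t s → applyWord t (range (suc s) (length M))) (sym (++-assoc A (m ∷ []) (x ∷ M ++ R))) (sym (length-∷ʳ A m)) ⟩
  applyWord ((A ∷ʳ m) ++ x ∷ M ++ R) (range (suc (length (A ∷ʳ m))) (length M))
    ≡⟨ applyWord-range-rotates M (A ∷ʳ m) x R ⟩
  (A ∷ʳ m) ++ M ++ x ∷ R
    ≡⟨ ++-assoc A (m ∷ []) (M ++ x ∷ R) ⟩
  A ++ m ∷ M ++ x ∷ R ∎
  where open ≡-Reasoning

block-rotates : ∀ A (x : ℕ) M R i j → 1 ≤ i → length A ≡ i ∸ 1 → length M ≡ suc (j ∸ i) →
  applyWord (A ++ x ∷ M ++ R) (block i j) ≡ A ++ M ++ x ∷ R
block-rotates A x M R (suc i) j _ lA lM =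
  trans (cong (applyWord (A ++ x ∷ M ++ R)) (trans (block≡range (suc i) j) (cong₂ range (cong suc (sym lA)) (sym lM))))
    (applyWord-range-rotates M A x R)

data Chain : ℕ → ℕ → List (ℕ × ℕ) → Set where
  [] : ∀ {I J} → Chain I J []
  cons : ∀ {I J i j bs} → 1 ≤ i → i ≤ j → i < I → j < J → Chain i j bs → Chain I J ((i , j) ∷ bs)

chain-weaken : ∀ {I J I' J' bs} → Chain I J bs → I ≤ I' → J ≤ J' → Chain I' J' bs
chain-weaken [] _ _ = []
chain-weaken (cons 1≤i i≤j i<I j<J ch) p q = cons 1≤i i≤j (≤-trans i<I p) (≤-trans j<J q) ch

applyBlocks : List ℕ → List (ℕ × ℕ) → List ℕ
applyBlocks q bs = applyWord q (blocksWord bs)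

applyBlocks-∷ : ∀ q i j bs → applyBlocks q ((i , j) ∷ bs) ≡ applyBlocks (applyWord q (block i j)) bs
applyBlocks-∷ q i j bs = foldl-++ act q (block i j) (blocksWord bs)

applyBlocks-length : ∀ q bs → length (applyBlocks q bs) ≡ length q
applyBlocks-length q bs = ↭-length (applyWord-↭ q (blocksWord bs))

block-letters : ∀ i j {J} → 1 ≤ i → i ≤ j → j < J → All (λ k → 1 ≤ k × k < J) (block i j)
block-letters i j 1≤i i≤j j<J = subst (All _) (sym (block≡range i j))
  (All-range i (suc (j ∸ i)) (λ x i≤x x<end → ≤-trans 1≤i i≤x ,
     ≤-trans (subst (x <_) (trans (+-suc i (j ∸ i)) (cong suc (m+[n∸m]≡n i≤j))) x<end) j<J))

chain-letters : ∀ {I J bs} → Chain I J bs → All (λ k → 1 ≤ k × k < J) (blocksWord bs)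
chain-letters [] = []
chain-letters (cons {i = i} {j} 1≤i i≤j _ j<J ch) =
  All++⁺ (block-letters i j 1≤i i≤j j<J) (All.map (λ { (1≤k , k<j) → 1≤k , <-trans k<j j<J }) (chain-letters ch))

swapAt-++ : ∀ k (V W : List ℕ) → suc k ≤ length V → swapAt k (V ++ W) ≡ swapAt k V ++ W
swapAt-++ zero V W _ = refl
swapAt-++ (suc zero) (x ∷ y ∷ V) W _ = refl
swapAt-++ (suc zero) (x ∷ []) W (s≤s ())
swapAt-++ (suc (suc k)) (z ∷ V) W (s≤s le) = cong (z ∷_) (swapAt-++ (suc k) V W le)

applyWord-++ : ∀ w (V W : List ℕ) → All (λ k → suc k ≤ length V) w → applyWord (V ++ W) w ≡ applyWord V w ++ W
applyWord-++ [] V W _ = refl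
applyWord-++ (k ∷ w) V W (k<V ∷ w<V) = trans (cong (λ t → applyWord t w) (swapAt-++ k V W k<V))
  (applyWord-++ w (swapAt k V) W (All.map (λ k'<V → subst (_ ≤_) (sym (↭-length (swapAt-↭ k V))) k'<V) w<V))

applyBlocks-++ : ∀ {I J bs} (V W : List ℕ) → Chain I J bs → J ≤ length V → applyBlocks (V ++ W) bs ≡ applyBlocks V bs ++ W
applyBlocks-++ V W ch J≤V = applyWord-++ _ V W (All.map (λ { (_ , k<J) → ≤-trans k<J J≤V }) (chain-letters ch))

-- A chain is determined by its canonical word

module _ {A : Set} where

  ++-split-≤ : ∀ (xs ys us vs : List A) → xs ++ ys ≡ us ++ vs → length xs ≤ length us →
    ∃[ zs ] (us ≡ xs ++ zs × ys ≡ zs ++ vs)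
  ++-split-≤ [] ys us vs e _ = us , refl , e
  ++-split-≤ (x ∷ xs) ys (u ∷ us) vs e (s≤s le) with refl , e' ← ∷-injective e
    with zs , e1 , e2 ← ++-split-≤ xs ys us vs e' le = zs , cong (x ∷_) e1 , e2

  ++-∷-split-< : ∀ F (x : A) R F' x' R' → F ++ x ∷ R ≡ F' ++ x' ∷ R' → length F < length F' →
    ∃[ G ] (R ≡ G ++ x' ∷ R' × length F' ≡ suc (length F + length G))
  ++-∷-split-< F x R F' x' R' e lt with ++-split-≤ F (x ∷ R) F' (x' ∷ R') e (<⇒≤ lt)
  ... | [] , e1 , e2 = ⊥-elim (<-irrefl (sym (trans (cong length e1) (trans (length-++ F) (+-identityʳ _)))) lt)
  ... | (y ∷ G) , e1 , e2 = G , proj₂ (∷-injective e2) ,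
    trans (cong length e1) (trans (length-++ F) (+-suc (length F) (length G)))

  ++-∷-injective : ∀ F (x : A) R F' x' R' → F ++ x ∷ R ≡ F' ++ x' ∷ R' → length F ≡ length F' → x ≡ x'
  ++-∷-injective F x R F' x' R' e le with ++-split-≤ F (x ∷ R) F' (x' ∷ R') e (≤-reflexive le)
  ... | [] , e1 , e2 = proj₁ (∷-injective e2)
  ... | (y ∷ G) , e1 , e2 = ⊥-elim (<-irrefl (trans le (trans (cong length e1)
          (trans (length-++ F) (+-suc (length F) (length G))))) (s≤s (m≤m+n (length F) (length G))))

  unique-position : ∀ F (x : A) R F' R' → Unique (F ++ x ∷ R) → F ++ x ∷ R ≡ F' ++ x ∷ R' → length F ≡ length F'
  unique-position [] x R [] R' u e = refl
  unique-position [] x R (a ∷ F') R' (x∉R ∷ u) e with refl , e2 ← ∷-injective e =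
    ⊥-elim (All.head (++⁻ʳ F' (subst (All (x ≢_)) e2 x∉R)) refl)
  unique-position (a ∷ F) x R [] R' (a∉ ∷ u) e with refl , e2 ← ∷-injective e = ⊥-elim (All.head (++⁻ʳ F a∉) refl)
  unique-position (a ∷ F) x R (a' ∷ F') R' (_ ∷ u) e with refl , e2 ← ∷-injective e =
    cong suc (unique-position F x R F' R' u e2)

  splitAt-length : ∀ c (q : List A) → c ≤ length q → ∃[ M ] ∃[ R ] (q ≡ M ++ R × length M ≡ c)
  splitAt-length zero q _ = [] , q , refl , refl
  splitAt-length (suc c) (y ∷ q) (s≤s le) with M , R , e , l ← splitAt-length c q le = y ∷ M , R , cong (y ∷_) e , cong suc l

  splitAt-entry : ∀ a c (q : List A) → a + suc c ≤ length q →
    ∃[ F ] ∃[ x ] ∃[ M ] ∃[ R ] (q ≡ F ++ x ∷ M ++ R × length F ≡ a × length M ≡ c)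
  splitAt-entry zero c (x ∷ q) (s≤s le) with M , R , e , l ← splitAt-length c q le = [] , x , M , R , cong (x ∷_) e , refl , l
  splitAt-entry (suc a) c (y ∷ q) (s≤s le) with F , x , M , R , e , lF , lM ← splitAt-entry a c q le =
    y ∷ F , x , M , R , cong (y ∷_) e , cong suc lF , lM

pred+suc[∸]≡ : ∀ i j → 1 ≤ i → i ≤ j → (i ∸ 1) + suc (j ∸ i) ≡ j
pred+suc[∸]≡ (suc i) j _ le = trans (+-suc i (j ∸ suc i)) (m+[n∸m]≡n le)

-- The leading block [i , j] of a chain takes the entry x in position i of q to position j + 1,
-- and the remaining blocks only touch the first j positions.
record BlockSplit (q : List ℕ) (i j : ℕ) (r : List (ℕ × ℕ)) : Set where
  field
    A : List ℕ
    x : ℕ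
    M R F : List ℕ
    q≡ : q ≡ A ++ x ∷ M ++ R
    length-A : length A ≡ i ∸ 1
    length-M : length M ≡ suc (j ∸ i)
    block-step : applyWord q (block i j) ≡ A ++ M ++ x ∷ R
    result : applyBlocks q ((i , j) ∷ r) ≡ F ++ x ∷ R
    length-F : length F ≡ j

blockSplit : ∀ q i j r → 1 ≤ i → i ≤ j → suc j ≤ length q → Chain i j r → BlockSplit q i j r
blockSplit q i j r 1≤i i≤j j<q ch
  with A , x , M , R , q≡ , lA , lM ← splitAt-entry (i ∸ 1) (suc (j ∸ i)) q
         (subst (_≤ length q) (sym (trans (+-suc (i ∸ 1) (suc (j ∸ i))) (cong suc (pred+suc[∸]≡ i j 1≤i i≤j)))) j<q) =
  record
  { A = A ; x = x ; M = M ; R = R ; F = applyBlocks (A ++ M) r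
  ; q≡ = q≡ ; length-A = lA ; length-M = lM ; block-step = step
  ; result = begin
      applyBlocks q ((i , j) ∷ r)          ≡⟨ applyBlocks-∷ q i j r ⟩
      applyBlocks (applyWord q (block i j)) r ≡⟨ cong (λ t → applyBlocks t r) step ⟩
      applyBlocks (A ++ M ++ x ∷ R) r      ≡⟨ cong (λ t → applyBlocks t r) (++-assoc A M (x ∷ R)) ⟨
      applyBlocks ((A ++ M) ++ x ∷ R) r    ≡⟨ applyBlocks-++ (A ++ M) (x ∷ R) ch (≤-reflexive (sym length-AM)) ⟩
      applyBlocks (A ++ M) r ++ x ∷ R      ∎
  ; length-F = trans (applyBlocks-length (A ++ M) r) length-AM }
  where
  open ≡-Reasoning
  step : applyWord q (block i j) ≡ A ++ M ++ x ∷ R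
  step = trans (cong (λ t → applyWord t (block i j)) q≡) (block-rotates A x M R i j 1≤i lA lM)
  length-AM : length (A ++ M) ≡ j
  length-AM = trans (length-++ A) (trans (cong₂ _+_ lA lM) (pred+suc[∸]≡ i j 1≤i i≤j))

pred< : ∀ {i j} → 1 ≤ i → i ≤ j → i ∸ 1 < j
pred< {suc i} _ le = le

-- If the first block of one chain ended before that of another, the entry that the latter moves
-- would sit both in position i' and, untouched, in position j' + 1 > i' of q.
blockSplit-end-≮ : ∀ {q i j r i' j' r'} → Unique q → 1 ≤ i → i ≤ j → 1 ≤ i' → i' ≤ j' →
  (s : BlockSplit q i j r) (s' : BlockSplit q i' j' r') →
  applyBlocks q ((i , j) ∷ r) ≡ applyBlocks q ((i' , j') ∷ r') → ¬ j < j'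
blockSplit-end-≮ {q} {i} {j} {r} {i'} {j'} uq 1≤i i≤j 1≤i' i'≤j' s s' e j<j' =
  absurd-split (++-∷-split-< F x R F' x' R' (trans (sym result) (trans e result'))
                  (subst₂ _<_ (sym length-F) (sym length-F') j<j'))
  where
  open BlockSplit s
  open BlockSplit s' using ()
    renaming (A to A'; x to x'; M to M'; R to R'; F to F'; q≡ to q≡'; length-A to length-A'; result to result'; length-F to length-F')
  absurd-split : ∃[ G ] (R ≡ G ++ x' ∷ R' × length F' ≡ suc (length F + length G)) → ⊥
  absurd-split (G , R≡ , F'≡) =
    <-irrefl (trans (sym same-position) length-prefix) (subst (_< j') (sym length-A') (pred< 1≤i' i'≤j'))
    where
    open ≡-Reasoning
    q≡G : q ≡ (A ++ x ∷ M ++ G) ++ x' ∷ R'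
    q≡G = begin
      q                               ≡⟨ q≡ ⟩
      A ++ x ∷ M ++ R                 ≡⟨ cong (λ t → A ++ x ∷ M ++ t) R≡ ⟩
      A ++ x ∷ M ++ G ++ x' ∷ R'      ≡⟨ cong (λ t → A ++ x ∷ t) (++-assoc M G (x' ∷ R')) ⟨
      A ++ x ∷ (M ++ G) ++ x' ∷ R'    ≡⟨ ++-assoc A (x ∷ M ++ G) (x' ∷ R') ⟨
      (A ++ x ∷ M ++ G) ++ x' ∷ R'    ∎
    same-position : length (A ++ x ∷ M ++ G) ≡ length A'
    same-position = unique-position (A ++ x ∷ M ++ G) x' R' A' (M' ++ R') (subst Unique q≡G uq) (trans (sym q≡G) q≡')
    regroup : ∀ a b c → a + suc (b + c) ≡ suc (a + b + c)
    regroup = solve-∀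
    length-prefix : length (A ++ x ∷ M ++ G) ≡ j'
    length-prefix = begin
      length (A ++ x ∷ M ++ G)              ≡⟨ length-++ A ⟩
      length A + suc (length (M ++ G))      ≡⟨ cong (λ t → length A + suc t) (length-++ M) ⟩
      length A + suc (length M + length G)  ≡⟨ regroup (length A) (length M) (length G) ⟩
      suc (length A + length M + length G)  ≡⟨ cong (λ t → suc (t + length G)) (trans (cong₂ _+_ length-A length-M) (pred+suc[∸]≡ i j 1≤i i≤j)) ⟩
      suc (j + length G)                    ≡⟨ cong (λ t → suc (t + length G)) length-F ⟨
      suc (length F + length G)             ≡⟨ F'≡ ⟨
      length F'                             ≡⟨ length-F' ⟩
      j'                                    ∎

applyBlocks-∷-≢ : ∀ {q i j r} → Unique q → 1 ≤ i → i ≤ j → BlockSplit q i j r → q ≢ applyBlocks q ((i , j) ∷ r)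
applyBlocks-∷-≢ {q} {i} {j} uq 1≤i i≤j s e =
  <-irrefl (trans (sym length-A) (trans same-position length-F)) (pred< 1≤i i≤j)
  where
  open BlockSplit s
  same-position : length A ≡ length F
  same-position = unique-position A x (M ++ R) F R (subst Unique q≡ uq) (trans (sym q≡) (trans e result))

-- With equal end points the two blocks move the same entry, so they start in the same position.
blockSplit-start-≡ : ∀ {q i j r i' r'} → Unique q → (s : BlockSplit q i j r) (s' : BlockSplit q i' j r') →
  applyBlocks q ((i , j) ∷ r) ≡ applyBlocks q ((i' , j) ∷ r') → i ∸ 1 ≡ i' ∸ 1
blockSplit-start-≡ {q} uq s s' e = trans (sym length-A) (trans same-position length-A')
  where
  open BlockSplit s
  open BlockSplit s' using ()
    renaming (A to A'; x to x'; M to M'; R to R'; F to F'; q≡ to q≡'; length-A to length-A'; result to result'; length-F to length-F')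
  x≡x' : x ≡ x'
  x≡x' = ++-∷-injective F x R F' x' R' (trans (sym result) (trans e result')) (trans length-F (sym length-F'))
  same-position : length A ≡ length A'
  same-position = unique-position A x (M ++ R) A' (M' ++ R') (subst Unique q≡ uq)
    (trans (sym q≡) (trans q≡' (cong (λ t → A' ++ t ∷ M' ++ R') (sym x≡x'))))

chain-applyBlocks-injective : ∀ q {I J bs bs'} → Unique q → J ≤ length q → Chain I J bs → Chain I J bs' →
  applyBlocks q bs ≡ applyBlocks q bs' → bs ≡ bs'
chain-applyBlocks-injective q uq J≤q [] [] e = refl
chain-applyBlocks-injective q uq J≤q [] (cons 1≤i i≤j _ j<J ch) e =
  ⊥-elim (applyBlocks-∷-≢ uq 1≤i i≤j (blockSplit q _ _ _ 1≤i i≤j (≤-trans j<J J≤q) ch) e)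
chain-applyBlocks-injective q uq J≤q (cons 1≤i i≤j _ j<J ch) [] e =
  ⊥-elim (applyBlocks-∷-≢ uq 1≤i i≤j (blockSplit q _ _ _ 1≤i i≤j (≤-trans j<J J≤q) ch) (sym e))
chain-applyBlocks-injective q uq J≤q (cons {i = i} {j} {r} 1≤i@(s≤s z≤n) i≤j _ j<J ch)
                                     (cons {i = i'} {j'} {r'} 1≤i'@(s≤s z≤n) i'≤j' _ j'<J ch') e
  with s ← blockSplit q i j r 1≤i i≤j (≤-trans j<J J≤q) ch | s' ← blockSplit q i' j' r' 1≤i' i'≤j' (≤-trans j'<J J≤q) ch'
  with <-cmp j j'
... | tri< j<j' _ _ = ⊥-elim (blockSplit-end-≮ uq 1≤i i≤j 1≤i' i'≤j' s s' e j<j')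
... | tri> _ _ j'<j = ⊥-elim (blockSplit-end-≮ uq 1≤i' i'≤j' 1≤i i≤j s' s (sym e) j'<j)
... | tri≈ _ refl _ with refl ← blockSplit-start-≡ uq s s' e =
  cong ((i , j) ∷_) (chain-applyBlocks-injective (applyWord q (block i j))
    (Perm≡.Unique-resp-↭ (setoid ℕ) (↭⇒↭ₛ (↭-sym (applyWord-↭ q (block i j)))) uq)
    (subst (j ≤_) (sym (↭-length (applyWord-↭ q (block i j)))) (≤-trans (n≤1+n j) (≤-trans j<J J≤q)))
    ch ch' (trans (sym (applyBlocks-∷ q i j r)) (trans e (applyBlocks-∷ q i j r'))))

-- Canonical words give 321-avoiding permutations

sorted-++⁻ˡ : ∀ xs {ys} → Sorted (xs ++ ys) → Sorted xs
sorted-++⁻ˡ [] _ = []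
sorted-++⁻ˡ (x ∷ xs) (x≤ ∷ s) = ++⁻ˡ xs x≤ ∷ sorted-++⁻ˡ xs s

sorted-++⁻ʳ : ∀ xs {ys} → Sorted (xs ++ ys) → Sorted ys
sorted-++⁻ʳ [] s = s
sorted-++⁻ʳ (x ∷ xs) (_ ∷ s) = sorted-++⁻ʳ xs s

sorted-delete : ∀ A (x : ℕ) M → Sorted (A ++ x ∷ M) → Sorted (A ++ M)
sorted-delete [] x M (_ ∷ s) = s
sorted-delete (y ∷ A) x M (y≤ ∷ s) with y≤A , (_ ∷ y≤M) ← ++⁻ A y≤ = All++⁺ y≤A y≤M ∷ sorted-delete A x M s

≤-all⇒no21Below : ∀ x L → All (x ≤_) L → No21Below x L
≤-all⇒no21Below x [] _ = tt
≤-all⇒no21Below x (y ∷ L) (x≤y ∷ x≤L) = (λ y<x → ⊥-elim (<⇒≱ y<x x≤y)) , ≤-all⇒no21Below x L x≤L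

sorted⇒avoids321 : ∀ {q} → Sorted q → Avoids321 q
sorted⇒avoids321 [] = tt
sorted⇒avoids321 {x ∷ q} (x≤q ∷ s) = ≤-all⇒no21Below x q x≤q , sorted⇒avoids321 s

avoids321-++⁻ʳ : ∀ xs {ys} → Avoids321 (xs ++ ys) → Avoids321 ys
avoids321-++⁻ʳ [] a = a
avoids321-++⁻ʳ (x ∷ xs) (_ , a) = avoids321-++⁻ʳ xs a

no21Below-++⁻ʳ : ∀ m xs {ys} → No21Below m (xs ++ ys) → No21Below m ys
no21Below-++⁻ʳ m [] n = n
no21Below-++⁻ʳ m (x ∷ xs) (_ , n) = no21Below-++⁻ʳ m xs n

no21Below-insert : ∀ m M {x R} → All (m ≤_) M → No21Below m R → All (x <_) R → No21Below m (M ++ x ∷ R)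
no21Below-insert m [] _ nR x<R = (λ _ → All.map <⇒≤ x<R) , nR
no21Below-insert m (y ∷ M) (m≤y ∷ m≤M) nR x<R = (λ y<m → ⊥-elim (<⇒≱ y<m m≤y)) , no21Below-insert m M m≤M nR x<R

avoids321-insert : ∀ M {x R} → Sorted M → All (x <_) (M ++ R) → Avoids321 (M ++ R) → Avoids321 (M ++ x ∷ R)
avoids321-insert [] {x} {R} _ x< av = ≤-all⇒no21Below x R (All.map <⇒≤ x<) , av
avoids321-insert (m ∷ M) {x} {R} (m≤M ∷ sM) (_ ∷ x<) (nd , av) =
  no21Below-insert m M m≤M (no21Below-++⁻ʳ m M nd) (++⁻ʳ M x<) , avoids321-insert M sM x< av

LeftMinima : List ℕ → List ℕ → Set
LeftMinima [] L = ⊤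
LeftMinima (a ∷ A) L = All (a <_) (A ++ L) × LeftMinima A L

leftMinima-↭ : ∀ A {L L'} → L ↭ L' → LeftMinima A L → LeftMinima A L'
leftMinima-↭ [] p _ = tt
leftMinima-↭ (a ∷ A) p (a< , lm) = All-resp-↭ (++⁺ˡ A p) a< , leftMinima-↭ A p lm

leftMinima-++⁻ : ∀ A B L → LeftMinima (A ++ B) L → LeftMinima A (B ++ L) × LeftMinima B L
leftMinima-++⁻ [] B L lm = tt , lm
leftMinima-++⁻ (a ∷ A) B L (a< , lm) with lmA , lmB ← leftMinima-++⁻ A B L lm =
  (subst (All (a <_)) (++-assoc A B L) a< , lmA) , lmB

leftMinima-avoids321 : ∀ A {L} → LeftMinima A L → Avoids321 L → Avoids321 (A ++ L)
leftMinima-avoids321 [] _ av = av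
leftMinima-avoids321 (a ∷ A) {L} (a< , lm) av = ≤-all⇒no21Below a (A ++ L) (All.map <⇒≤ a<) , leftMinima-avoids321 A lm av

range-leftMinima : ∀ P S b m → range b m ≡ P ++ S → LeftMinima P S
range-leftMinima [] S b m e = tt
range-leftMinima (p ∷ P) S b (suc m) e with refl , e' ← ∷-injective e =
  subst (All (p <_)) e' (All-range (suc p) m (λ x p<x _ → p<x)) , range-leftMinima P S (suc p) m e'

avoids321-rotate : ∀ A (x : ℕ) M R → Avoids321 (A ++ x ∷ M ++ R) → LeftMinima A (x ∷ M ++ R) →
  All (x <_) (M ++ R) → Sorted M → Avoids321 (A ++ M ++ x ∷ R)
avoids321-rotate A x M R av lm x< sM =
  leftMinima-avoids321 A (leftMinima-↭ A (↭-sym (shift x M R)) lm) (avoids321-insert M sM x< (proj₂ (avoids321-++⁻ʳ A av)))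

leftMinima-prefix : ∀ {P S A x Rest} → LeftMinima P S → P ++ S ≡ A ++ x ∷ Rest → length A < length P →
  LeftMinima A (x ∷ Rest) × All (x <_) Rest
leftMinima-prefix {P} {S} {A} {x} {Rest} lm e A<P with ++-split-≤ A (x ∷ Rest) P S (sym e) (<⇒≤ A<P)
... | [] , P≡ , _ = ⊥-elim (<-irrefl (sym (trans (cong length P≡) (trans (length-++ A) (+-identityʳ _)))) A<P)
... | (y ∷ E) , P≡ , Rest≡ with refl , Rest≡' ← ∷-injective Rest≡
  with lmA , (x< , _) ← leftMinima-++⁻ A (x ∷ E) S (subst (λ t → LeftMinima t S) P≡ lm) =
  subst (LeftMinima A) (cong (x ∷_) (sym Rest≡')) lmA , subst (All (x <_)) (sym Rest≡') x<

sorted-prefix : ∀ {T U B R} → Sorted T → T ++ U ≡ B ++ R → length B ≤ length T → Sorted B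
sorted-prefix {T} {U} {B} {R} sT e B≤T with E , T≡ , _ ← ++-split-≤ B R T U (sym e) B≤T =
  sorted-++⁻ˡ B (subst Sorted T≡ sT)

record ChainInvariant (q : List ℕ) (I J : ℕ) : Set where
  field
    avoids : Avoids321 q
    P S : List ℕ
    q≡PS : q ≡ P ++ S
    length-P : length P ≡ I ∸ 1
    leftMinima : LeftMinima P S
    T U : List ℕ
    q≡TU : q ≡ T ++ U
    length-T : length T ≡ J
    sorted : Sorted T

chainInvariant-length : ∀ {q I J} → ChainInvariant q I J → J ≤ length q
chainInvariant-length {q} ci = subst (_≤ length q) length-T
  (subst (length T ≤_) (sym (trans (cong length q≡TU) (length-++ T))) (m≤m+n _ _))
  where open ChainInvariant ci

chainInvariant-idPerm : ∀ n → ChainInvariant (idPerm n) (suc n) (suc n)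
chainInvariant-idPerm n
  with P , S , e , l ← splitAt-length n (idPerm n) (≤-trans (n≤1+n n) (≤-reflexive (sym (length-applyUpTo (λ t → t) (suc n))))) =
  record
  { avoids = sorted⇒avoids321 (idPerm-sorted n)
  ; P = P ; S = S ; q≡PS = e ; length-P = l
  ; leftMinima = range-leftMinima P S 0 (suc n) (trans (sym (idPerm≡range n)) e)
  ; T = idPerm n ; U = [] ; q≡TU = sym (++-identityʳ _)
  ; length-T = length-applyUpTo (λ t → t) (suc n)
  ; sorted = idPerm-sorted n }

chainInvariant-block : ∀ {q I J i j} → ChainInvariant q I J → 1 ≤ i → i ≤ j → i < I → j < J →
  ChainInvariant (applyWord q (block i j)) i j
chainInvariant-block {q} {I} {J} {i} {j} ci 1≤i i≤j i<I j<J = record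
  { avoids = subst Avoids321 (sym block-step)
      (avoids321-rotate A x M R (subst Avoids321 q≡ (ChainInvariant.avoids ci)) lmA x<MR sM)
  ; P = A ; S = M ++ x ∷ R ; q≡PS = block-step ; length-P = length-A
  ; leftMinima = leftMinima-↭ A (↭-sym (shift x M R)) lmA
  ; T = A ++ M ; U = x ∷ R ; q≡TU = trans block-step (sym (++-assoc A M (x ∷ R)))
  ; length-T = trans (length-++ A) (trans (cong₂ _+_ length-A length-M) (pred+suc[∸]≡ i j 1≤i i≤j))
  ; sorted = sorted-delete A x M sAxM }
  where
  s : BlockSplit q i j []
  s = blockSplit q i j [] 1≤i i≤j (≤-trans j<J (chainInvariant-length ci)) []
  open BlockSplit s
  open ChainInvariant ci using (P; S; q≡PS; length-P; leftMinima; T; U; q≡TU; length-T; sorted)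
  A<P : length A < length P
  A<P = subst₂ _<_ (sym length-A) (sym length-P) (∸-monoˡ-< i<I 1≤i)
  minima : LeftMinima A (x ∷ M ++ R) × All (x <_) (M ++ R)
  minima = leftMinima-prefix leftMinima (trans (sym q≡PS) q≡) A<P
  lmA : LeftMinima A (x ∷ M ++ R)
  lmA = proj₁ minima
  x<MR : All (x <_) (M ++ R)
  x<MR = proj₂ minima
  sAxM : Sorted (A ++ x ∷ M)
  sAxM = sorted-prefix sorted (trans (sym q≡TU) (trans q≡ (sym (++-assoc A (x ∷ M) R))))
    (subst₂ _≤_ (sym (trans (length-++ A) (trans (+-suc (length A) (length M))
      (cong suc (trans (cong₂ _+_ length-A length-M) (pred+suc[∸]≡ i j 1≤i i≤j)))))) (sym length-T) j<J)
  sM : Sorted M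
  sM = sorted-++⁻ʳ A (sorted-delete A x M sAxM)

chain-avoids321 : ∀ q {I J bs} → ChainInvariant q I J → Chain I J bs → Avoids321 (applyBlocks q bs)
chain-avoids321 q ci [] = ChainInvariant.avoids ci
chain-avoids321 q ci (cons {i = i} {j} {bs} 1≤i i≤j i<I j<J ch) =
  subst Avoids321 (sym (applyBlocks-∷ q i j bs)) (chain-avoids321 _ (chainInvariant-block ci 1≤i i≤j i<I j<J) ch)

module _ {A : Set} where

  length-concatMap : ∀ (f : ℕ → List A) ks → length (concatMap f ks) ≡ sum (map (λ k → length (f k)) ks)
  length-concatMap f [] = refl
  length-concatMap f (k ∷ ks) = trans (length-++ (f k)) (cong (length (f k) +_) (length-concatMap f ks))

  ∈-concatMap⁻′ : ∀ (f : ℕ → List A) ks {x} → x ∈ concatMap f ks → ∃[ k ] (k ∈ ks × x ∈ f k)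
  ∈-concatMap⁻′ f ks m = find (∈-concatMap⁻ f m)

  ∈-concatMap⁺′ : ∀ (f : ℕ → List A) ks {x k} → k ∈ ks → x ∈ f k → x ∈ concatMap f ks
  ∈-concatMap⁺′ f ks k∈ x∈ = ∈-concatMap⁺ f (lose k∈ x∈)

  concatMap-unique : ∀ (f : ℕ → List A) ks → Unique ks → (∀ k → Unique (f k)) →
    (∀ {k k' x} → x ∈ f k → x ∈ f k' → k ≡ k') → Unique (concatMap f ks)
  concatMap-unique f [] _ _ _ = []
  concatMap-unique f (k ∷ ks) (k∉ks ∷ uks) uf fibre = Unique-++⁺ (uf k) (concatMap-unique f ks uks uf fibre) disjoint
    where
    disjoint : ∀ {x} → x ∈ f k × x ∈ concatMap f ks → ⊥
    disjoint (x∈k , x∈ks) with k' , k'∈ks , x∈k' ← ∈-concatMap⁻′ f ks x∈ks = All.lookup k∉ks k'∈ks (fibre x∈k x∈k')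

∈-range⁻ : ∀ {x} lo k → x ∈ range lo k → lo ≤ x × x < lo + k
∈-range⁻ {x} lo k x∈ = All.lookup (All-range lo k (λ y lo≤y y< → lo≤y , y<)) x∈

∈-range⁺ : ∀ {x} lo k → lo ≤ x → x < lo + k → x ∈ range lo k
∈-range⁺ {x} lo zero lo≤x x< = ⊥-elim (<⇒≱ (subst (x <_) (+-identityʳ lo) x<) lo≤x)
∈-range⁺ {x} lo (suc k) lo≤x x< with m≤n⇒m<n∨m≡n lo≤x
... | inj₂ refl = here refl
... | inj₁ lo<x = there (∈-range⁺ (suc lo) k lo<x (subst (x <_) (+-suc lo k) x<))

range-unique : ∀ lo k → Unique (range lo k)
range-unique lo zero = []
range-unique lo (suc k) = All-range (suc lo) k (λ x lo<x _ lo≡x → <-irrefl lo≡x lo<x) ∷ range-unique (suc lo) k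

<+∸⇒< : ∀ {x} lo b → lo ≤ x → x < lo + (b ∸ lo) → x < b
<+∸⇒< {x} lo b lo≤x x< with lo ≤? b
... | yes lo≤b = subst (x <_) (m+[n∸m]≡n lo≤b) x<
... | no lo≰b = ⊥-elim (<⇒≱ (subst (x <_) (trans (cong (lo +_) (m≤n⇒m∸n≡0 (<⇒≤ (≰⇒> lo≰b)))) (+-identityʳ lo)) x<) lo≤x)

∈-range-∸⁻ : ∀ {x} lo b → x ∈ range lo (b ∸ lo) → lo ≤ x × x < b
∈-range-∸⁻ lo b x∈ with lo≤x , x< ← ∈-range⁻ lo (b ∸ lo) x∈ = lo≤x , <+∸⇒< lo b lo≤x x<

∈-range-∸⁺ : ∀ {x} lo b → lo ≤ x → x < b → x ∈ range lo (b ∸ lo)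
∈-range-∸⁺ {x} lo b lo≤x x<b = ∈-range⁺ lo (b ∸ lo) lo≤x (subst (x <_) (sym (m+[n∸m]≡n (≤-trans lo≤x (<⇒≤ x<b)))) x<b)

chainsBelow : ℕ → ℕ → List (List (ℕ × ℕ))
chainsBelow zero b = [] ∷ []
chainsBelow (suc a) b = chainsBelow a b ++ concatMap (λ j → map ((suc a , j) ∷_) (chainsBelow a j)) (range (suc a) (b ∸ suc a))

chainsBelow-sound : ∀ a b {r} → r ∈ chainsBelow a b → Chain (suc a) b r
chainsBelow-sound zero b (here refl) = []
chainsBelow-sound (suc a) b r∈ with ∈-++⁻ (chainsBelow a b) r∈
... | inj₁ r∈old = chain-weaken (chainsBelow-sound a b r∈old) (n≤1+n _) ≤-refl
... | inj₂ r∈new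
  with j , j∈ , r∈j ← ∈-concatMap⁻′ _ (range (suc a) (b ∸ suc a)) r∈new
  with r' , r'∈ , refl ← ∈-map⁻ _ r∈j | a<j , j<b ← ∈-range-∸⁻ (suc a) b j∈ =
  cons (s≤s z≤n) a<j ≤-refl j<b (chainsBelow-sound a j r'∈)

chainsBelow-complete : ∀ a b {r} → Chain (suc a) b r → r ∈ chainsBelow a b
chainsBelow-complete zero b [] = here refl
chainsBelow-complete zero b (cons (s≤s z≤n) _ (s≤s ()) _ _)
chainsBelow-complete (suc a) b [] = ∈-++⁺ˡ (chainsBelow-complete a b [])
chainsBelow-complete (suc a) b (cons {i = i} {j} 1≤i i≤j i≤a j<b ch) with m≤n⇒m<n∨m≡n (≤-pred i≤a)
... | inj₁ i<a = ∈-++⁺ˡ (chainsBelow-complete a b (cons 1≤i i≤j i<a j<b ch))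
... | inj₂ refl = ∈-++⁺ʳ (chainsBelow a b)
  (∈-concatMap⁺′ _ (range (suc a) (b ∸ suc a)) (∈-range-∸⁺ (suc a) b i≤j j<b) (∈-map⁺ _ (chainsBelow-complete a j ch)))

chainsBelow-unique : ∀ a b → Unique (chainsBelow a b)
chainsBelow-unique zero b = [] ∷ []
chainsBelow-unique (suc a) b = Unique-++⁺ (chainsBelow-unique a b)
  (concatMap-unique _ (range (suc a) (b ∸ suc a)) (range-unique _ _)
    (λ j → Unique-map⁺ ∷-injectiveʳ (chainsBelow-unique a j)) same-head)
  disjoint
  where
  same-head : ∀ {k k' r} → r ∈ map ((suc a , k) ∷_) (chainsBelow a k) → r ∈ map ((suc a , k') ∷_) (chainsBelow a k') → k ≡ k'
  same-head r∈k r∈k' with _ , _ , refl ← ∈-map⁻ _ r∈k | _ , _ , e ← ∈-map⁻ _ r∈k' = cong proj₂ (∷-injectiveˡ e)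
  disjoint : ∀ {r} → r ∈ chainsBelow a b × r ∈ concatMap (λ j → map ((suc a , j) ∷_) (chainsBelow a j)) (range (suc a) (b ∸ suc a)) → ⊥
  disjoint (r∈old , r∈new)
    with j , _ , r∈j ← ∈-concatMap⁻′ _ (range (suc a) (b ∸ suc a)) r∈new
    with _ , _ , refl ← ∈-map⁻ _ r∈j
    with cons _ _ a<a _ _ ← chainsBelow-sound a b r∈old = <-irrefl refl a<a

-- The ballot numbers

chainCount : ℕ → ℕ → ℕ
chainCount a b = length (chainsBelow a b)

chainCount-suc : ∀ a b → chainCount (suc a) b ≡ chainCount a b + sum (map (chainCount a) (range (suc a) (b ∸ suc a)))
chainCount-suc a b = trans (length-++ (chainsBelow a b)) (cong (chainCount a b +_)
  (trans (length-concatMap _ (range (suc a) (b ∸ suc a)))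
    (cong sum (map-cong (λ k → length-map ((suc a , k) ∷_) (chainsBelow a k)) (range (suc a) (b ∸ suc a))))))

range-∷ʳ : ∀ lo k → range lo (suc k) ≡ range lo k ∷ʳ (lo + k)
range-∷ʳ lo zero = cong (_∷ []) (sym (+-identityʳ lo))
range-∷ʳ lo (suc k) = cong (lo ∷_) (trans (range-∷ʳ (suc lo) k) (cong (range (suc lo) k ∷ʳ_) (sym (+-suc lo k))))

sum-map-∷ʳ : ∀ (g : ℕ → ℕ) xs x → sum (map g (xs ∷ʳ x)) ≡ sum (map g xs) + g x
sum-map-∷ʳ g xs x = trans (cong sum (map-++ g xs (x ∷ []))) (trans (sum-++ (map g xs) (g x ∷ [])) (cong (sum (map g xs) +_) (+-identityʳ (g x))))

∸-suc : ∀ a b → a < b → b ∸ a ≡ suc (b ∸ suc a)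
∸-suc zero (suc b) _ = refl
∸-suc (suc a) (suc b) (s≤s a<b) = ∸-suc a b a<b

chainCount-pascal : ∀ a b → a < b → chainCount (suc a) (suc b) ≡ chainCount (suc a) b + chainCount a (suc b)
chainCount-pascal a b a<b = begin
  chainCount (suc a) (suc b)
    ≡⟨ chainCount-suc a (suc b) ⟩
  chainCount a (suc b) + sum (map (chainCount a) (range (suc a) (b ∸ a)))
    ≡⟨ cong (λ t → chainCount a (suc b) + sum (map (chainCount a) (range (suc a) t))) (∸-suc a b a<b) ⟩
  chainCount a (suc b) + sum (map (chainCount a) (range (suc a) (suc (b ∸ suc a))))
    ≡⟨ cong (λ t → chainCount a (suc b) + sum (map (chainCount a) t)) (range-∷ʳ (suc a) (b ∸ suc a)) ⟩
  chainCount a (suc b) + sum (map (chainCount a) (range (suc a) (b ∸ suc a) ∷ʳ (suc a + (b ∸ suc a))))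
    ≡⟨ cong (chainCount a (suc b) +_) (sum-map-∷ʳ (chainCount a) (range (suc a) (b ∸ suc a)) _) ⟩
  chainCount a (suc b) + (sum (map (chainCount a) (range (suc a) (b ∸ suc a))) + chainCount a (suc a + (b ∸ suc a)))
    ≡⟨ cong (λ t → chainCount a (suc b) + (sum (map (chainCount a) (range (suc a) (b ∸ suc a))) + chainCount a t)) (m+[n∸m]≡n a<b) ⟩
  chainCount a (suc b) + (sum (map (chainCount a) (range (suc a) (b ∸ suc a))) + chainCount a b)
    ≡⟨ rotate (chainCount a (suc b)) _ (chainCount a b) ⟩
  (chainCount a b + sum (map (chainCount a) (range (suc a) (b ∸ suc a)))) + chainCount a (suc b)
    ≡⟨ cong (_+ chainCount a (suc b)) (chainCount-suc a b) ⟨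
  chainCount (suc a) b + chainCount a (suc b) ∎
  where
  open ≡-Reasoning
  rotate : ∀ x y z → x + (y + z) ≡ z + y + x
  rotate = solve-∀

chainCount-diagonal : ∀ a → chainCount (suc a) (suc a) ≡ chainCount a (suc a)
chainCount-diagonal a = trans (chainCount-suc a (suc a))
  (trans (cong (λ t → chainCount a (suc a) + sum (map (chainCount a) (range (suc a) t))) (n∸n≡0 a)) (+-identityʳ _))

C-pascal : ∀ m k → suc m C suc k ≡ m C k + m C suc k
C-pascal m k = sym (nCk+nC[k+1]≡[n+1]C[k+1] m k)

C-absorption : ∀ m k → suc k * (m C suc k) + k * (m C k) ≡ m * (m C k)
C-absorption zero zero = refl
C-absorption zero (suc k) = cong₂ _+_ (*-zeroʳ (suc (suc k))) (*-zeroʳ (suc k))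
C-absorption (suc m) zero = trans (+-identityʳ _) (trans (+-identityʳ _) (trans (nC1≡n (suc m)) (sym (*-identityʳ (suc m)))))
C-absorption (suc m) (suc k) = begin
  suc (suc k) * (suc m C suc (suc k)) + suc k * (suc m C suc k)
    ≡⟨ cong₂ (λ s t → suc (suc k) * s + suc k * t) (C-pascal m (suc k)) (C-pascal m k) ⟩
  suc (suc k) * (Y + Z) + suc k * (X + Y)
    ≡⟨ regroup k X Y Z ⟩
  (suc (suc k) * Z + suc k * Y) + (suc k * Y + k * X) + (X + Y)
    ≡⟨ cong₂ (λ s t → s + t + (X + Y)) (C-absorption m (suc k)) (C-absorption m k) ⟩
  m * Y + m * X + (X + Y)
    ≡⟨ collect m X Y ⟩
  suc m * (X + Y)
    ≡⟨ cong (suc m *_) (C-pascal m k) ⟨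
  suc m * (suc m C suc k) ∎
  where
  open ≡-Reasoning
  X = m C k
  Y = m C suc k
  Z = m C suc (suc k)
  regroup : ∀ k X Y Z → suc (suc k) * (Y + Z) + suc k * (X + Y) ≡ (suc (suc k) * Z + suc k * Y) + (suc k * Y + k * X) + (X + Y)
  regroup = solve-∀
  collect : ∀ m X Y → m * Y + m * X + (X + Y) ≡ suc m * (X + Y)
  collect = solve-∀

-- Counting chains by first entries ≤ a and second entries < b is a ballot problem:
-- the count satisfies the Pascal recurrence of  (a+b) C b − (a+b) C (b+1).
chainCount-ballot : ∀ a b → a ≤ b → chainCount a b + (a + b) C suc b ≡ (a + b) C b
chainCount-ballot zero b _ = trans (cong suc (k>n⇒nCk≡0 (n<1+n b))) (sym (nCn≡1 b))
chainCount-ballot (suc a) (suc b) (s≤s a≤b) with m≤n⇒m<n∨m≡n a≤b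
... | inj₂ refl = begin
  chainCount (suc a) (suc a) + suc M C suc (suc a)
    ≡⟨ cong₂ _+_ (chainCount-diagonal a) (C-pascal M (suc a)) ⟩
  chainCount a (suc a) + (M C suc a + M C suc (suc a))
    ≡⟨ swap-last (chainCount a (suc a)) (M C suc a) (M C suc (suc a)) ⟩
  (chainCount a (suc a) + M C suc (suc a)) + M C suc a
    ≡⟨ cong (_+ M C suc a) (chainCount-ballot a (suc a) (n≤1+n a)) ⟩
  M C suc a + M C suc a
    ≡⟨ cong (_+ M C suc a) middle-symmetric ⟨
  M C a + M C suc a
    ≡⟨ C-pascal M a ⟨
  suc M C suc a ∎
  where
  open ≡-Reasoning
  M = a + suc a
  swap-last : ∀ x y z → x + (y + z) ≡ x + z + y
  swap-last = solve-∀
  middle-symmetric : M C a ≡ M C suc a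
  middle-symmetric = trans (nCk≡nC[n∸k] (m≤m+n a (suc a))) (cong (M C_) (m+n∸m≡n a (suc a)))
... | inj₁ a<b = begin
  chainCount (suc a) (suc b) + suc M C suc (suc b)
    ≡⟨ cong₂ _+_ (chainCount-pascal a b a<b) (C-pascal M (suc b)) ⟩
  (chainCount (suc a) b + chainCount a (suc b)) + (M C suc b + M C suc (suc b))
    ≡⟨ interchange (chainCount (suc a) b) (chainCount a (suc b)) (M C suc b) (M C suc (suc b)) ⟩
  (chainCount (suc a) b + M C suc b) + (chainCount a (suc b) + M C suc (suc b))
    ≡⟨ cong₂ _+_ (subst (λ t → chainCount (suc a) b + t C suc b ≡ t C b) (sym (+-suc a b)) (chainCount-ballot (suc a) b a<b))
                 (chainCount-ballot a (suc b) (≤-trans a≤b (n≤1+n b))) ⟩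
  M C b + M C suc b
    ≡⟨ C-pascal M b ⟨
  suc M C suc b ∎
  where
  open ≡-Reasoning
  M = a + suc b
  interchange : ∀ p q r s → (p + q) + (r + s) ≡ (p + r) + (q + s)
  interchange = solve-∀

chainCount-formula : ∀ a b → a ≤ b → suc b * chainCount a b ≡ (suc b ∸ a) * ((a + b) C b)
chainCount-formula a b a≤b = begin
  suc b * chainCount a b         ≡⟨ cong (suc b *_) count≡ ⟩
  suc b * (B ∸ E)                ≡⟨ *-distribˡ-∸ (suc b) B E ⟩
  suc b * B ∸ suc b * E          ≡⟨ cong (suc b * B ∸_) absorbed ⟩
  suc b * B ∸ a * B              ≡⟨ *-distribʳ-∸ B (suc b) a ⟨
  (suc b ∸ a) * B                ∎
  where
  open ≡-Reasoning
  B = (a + b) C b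
  E = (a + b) C suc b
  count≡ : chainCount a b ≡ B ∸ E
  count≡ = trans (sym (m+n∸n≡m (chainCount a b) E)) (cong (_∸ E) (chainCount-ballot a b a≤b))
  absorbed : suc b * E ≡ a * B
  absorbed = begin
    suc b * E                          ≡⟨ m+n∸n≡m (suc b * E) (b * B) ⟨
    suc b * E + b * B ∸ b * B          ≡⟨ cong (_∸ b * B) (C-absorption (a + b) b) ⟩
    (a + b) * B ∸ b * B                ≡⟨ *-distribʳ-∸ B (a + b) b ⟨
    (a + b ∸ b) * B                    ≡⟨ cong (_* B) (m+n∸n≡m a b) ⟩
    a * B                              ∎

rangeDesc : ℕ → ℕ → List ℕ
rangeDesc lo zero = []
rangeDesc lo (suc k) = lo + k ∷ rangeDesc lo k

All-rangeDesc : ∀ {P : ℕ → Set} lo k → (∀ x → lo ≤ x → x < lo + k → P x) → All P (rangeDesc lo k)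
All-rangeDesc lo zero h = []
All-rangeDesc lo (suc k) h = h (lo + k) (m≤m+n lo k) (subst (lo + k <_) (sym (+-suc lo k)) ≤-refl)
  ∷ All-rangeDesc lo k (λ x lo≤x x< → h x lo≤x (subst (x <_) (sym (+-suc lo k)) (m<n⇒m<1+n x<)))

∈-rangeDesc⁻ : ∀ {x} lo k → x ∈ rangeDesc lo k → lo ≤ x × x < lo + k
∈-rangeDesc⁻ lo k x∈ = All.lookup (All-rangeDesc lo k (λ y lo≤y y< → lo≤y , y<)) x∈

∈-rangeDesc⁺ : ∀ {x} lo k → lo ≤ x → x < lo + k → x ∈ rangeDesc lo k
∈-rangeDesc⁺ {x} lo zero lo≤x x< = ⊥-elim (<⇒≱ (subst (x <_) (+-identityʳ lo) x<) lo≤x)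
∈-rangeDesc⁺ {x} lo (suc k) lo≤x x< with m≤n⇒m<n∨m≡n (≤-pred (subst (x <_) (+-suc lo k) x<))
... | inj₂ refl = here refl
... | inj₁ x<lo+k = there (∈-rangeDesc⁺ lo k lo≤x x<lo+k)

rangeDesc-unique : ∀ lo k → Unique (rangeDesc lo k)
rangeDesc-unique lo zero = []
rangeDesc-unique lo (suc k) = All-rangeDesc lo k (λ x _ x< e → <-irrefl (sym e) x<) ∷ rangeDesc-unique lo k

AllAbove : ℕ → ℕ → List (ℕ × ℕ) → Set
AllAbove i j r = All (λ b → i < proj₁ b × j < proj₂ b) r

allAbove-weaken : ∀ {i j i' j' r} → AllAbove i' j' r → i ≤ i' → j ≤ j' → AllAbove i j r
allAbove-weaken above i≤i' j≤j' = All.map (λ { (i'< , j'<) → ≤-<-trans i≤i' i'< , ≤-<-trans j≤j' j'< }) above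

chain-∷ʳ⁺ : ∀ {I J r i j} → Chain I J r → AllAbove i j r → 1 ≤ i → i ≤ j → i < I → j < J → Chain I J (r ∷ʳ (i , j))
chain-∷ʳ⁺ [] [] 1≤i i≤j i<I j<J = cons 1≤i i≤j i<I j<J []
chain-∷ʳ⁺ (cons p q i'<I j'<J ch) ((i<i' , j<j') ∷ above) 1≤i i≤j _ _ = cons p q i'<I j'<J (chain-∷ʳ⁺ ch above 1≤i i≤j i<i' j<j')

chain-∷ʳ⁻ : ∀ {I J} r {i j} → Chain I J (r ∷ʳ (i , j)) → Chain I J r × AllAbove i j r × (1 ≤ i × i ≤ j × i < I × j < J)
chain-∷ʳ⁻ [] (cons 1≤i i≤j i<I j<J []) = [] , [] , (1≤i , i≤j , i<I , j<J)
chain-∷ʳ⁻ (_ ∷ r) (cons p q i'<I j'<J ch) with ch' , above , (1≤i , i≤j , i<i' , j<j') ← chain-∷ʳ⁻ r ch =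
  cons p q i'<I j'<J ch' , (i<i' , j<j') ∷ above , (1≤i , i≤j , <-trans i<i' i'<I , <-trans j<j' j'<J)

chainsAbove : ℕ → ℕ → ℕ → List (List (ℕ × ℕ))
chainsAbove zero i j = [] ∷ []
chainsAbove (suc f) i j = chainsAbove f i (suc j) ++
  concatMap (λ i' → map (_∷ʳ (i' , suc j)) (chainsAbove f i' (suc j))) (rangeDesc (suc i) (suc j ∸ i))

suc-f+j : ∀ {f j n} → suc f + j ≡ n → f + suc j ≡ n
suc-f+j {f} {j} e = trans (+-suc f j) e

suc-f+j⇒< : ∀ {f j n} → suc f + j ≡ n → suc j ≤ n
suc-f+j⇒< {f} {j} e = subst (suc j ≤_) e (s≤s (m≤n+m j f))

chainsAbove-sound : ∀ n f i j {r} → f + j ≡ n → r ∈ chainsAbove f i j → Chain (suc n) (suc n) r × AllAbove i j r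
chainsAbove-sound n zero i j e (here refl) = [] , []
chainsAbove-sound n (suc f) i j e r∈ with ∈-++⁻ (chainsAbove f i (suc j)) r∈
... | inj₁ r∈old with ch , above ← chainsAbove-sound n f i (suc j) (suc-f+j e) r∈old = ch , allAbove-weaken above ≤-refl (n≤1+n j)
... | inj₂ r∈new
  with i' , i'∈ , r∈i' ← ∈-concatMap⁻′ _ (rangeDesc (suc i) (suc j ∸ i)) r∈new
  with r' , r'∈ , refl ← ∈-map⁻ _ r∈i' | i<i' , i'< ← ∈-rangeDesc⁻ (suc i) (suc j ∸ i) i'∈
  with ch , above ← chainsAbove-sound n f i' (suc j) (suc-f+j e) r'∈ =
  chain-∷ʳ⁺ ch above (≤-trans (s≤s z≤n) i<i') i'≤suc-j (s≤s (≤-trans i'≤suc-j (suc-f+j⇒< e))) (s≤s (suc-f+j⇒< e)) ,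
  All++⁺ (allAbove-weaken above (<⇒≤ i<i') (n≤1+n j)) ((i<i' , ≤-refl) ∷ [])
  where
  i'≤suc-j : i' ≤ suc j
  i'≤suc-j = ≤-pred (<+∸⇒< (suc i) (suc (suc j)) i<i' i'<)

chainsAbove-complete : ∀ n f i j {r} → f + j ≡ n → Chain (suc n) (suc n) r → AllAbove i j r → r ∈ chainsAbove f i j
chainsAbove-complete n zero i j e [] [] = here refl
chainsAbove-complete n zero i j refl (cons _ _ _ j'<n _) ((_ , j<j') ∷ _) = ⊥-elim (<⇒≱ j<j' (≤-pred j'<n))
chainsAbove-complete n (suc f) i j {r} e ch above with initLast r
... | [] = ∈-++⁺ˡ (chainsAbove-complete n f i (suc j) (suc-f+j e) [] [])
... | r' ∷ʳ′ (i' , j')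
  with ch' , above' , (_ , i'≤j' , _ , _) ← chain-∷ʳ⁻ r' ch | i<i' , j<j' ← All.head (++⁻ʳ r' above)
  with m≤n⇒m<n∨m≡n j<j'
... | inj₁ suc-j<j' = ∈-++⁺ˡ (chainsAbove-complete n f i (suc j) (suc-f+j e) ch
        (All++⁺ (allAbove-weaken above' (<⇒≤ i<i') (<⇒≤ suc-j<j')) ((i<i' , suc-j<j') ∷ [])))
... | inj₂ refl = ∈-++⁺ʳ (chainsAbove f i (suc j))
        (∈-concatMap⁺′ _ (rangeDesc (suc i) (suc j ∸ i))
          (∈-rangeDesc⁺ (suc i) (suc j ∸ i) i<i' (s≤s (subst (i' ≤_) (sym (m+[n∸m]≡n (≤-trans (<⇒≤ i<i') i'≤j'))) i'≤j')))
          (∈-map⁺ _ (chainsAbove-complete n f i' (suc j) (suc-f+j e) ch' above')))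

chainsAbove-unique : ∀ n f i j → f + j ≡ n → Unique (chainsAbove f i j)
chainsAbove-unique n zero i j e = [] ∷ []
chainsAbove-unique n (suc f) i j e = Unique-++⁺ (chainsAbove-unique n f i (suc j) (suc-f+j e))
  (concatMap-unique _ (rangeDesc (suc i) (suc j ∸ i)) (rangeDesc-unique _ _)
    (λ k → Unique-map⁺ (λ {x} {y} → ∷ʳ-injectiveˡ x y) (chainsAbove-unique n f k (suc j) (suc-f+j e))) same-last)
  disjoint
  where
  same-last : ∀ {k k' r} → r ∈ map (_∷ʳ (k , suc j)) (chainsAbove f k (suc j)) →
    r ∈ map (_∷ʳ (k' , suc j)) (chainsAbove f k' (suc j)) → k ≡ k'
  same-last r∈k r∈k' with y , _ , refl ← ∈-map⁻ _ r∈k | y' , _ , e ← ∈-map⁻ _ r∈k' = cong proj₁ (∷ʳ-injectiveʳ y y' e)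
  disjoint : ∀ {r} → r ∈ chainsAbove f i (suc j) ×
    r ∈ concatMap (λ i' → map (_∷ʳ (i' , suc j)) (chainsAbove f i' (suc j))) (rangeDesc (suc i) (suc j ∸ i)) → ⊥
  disjoint (r∈old , r∈new)
    with _ , _ , r∈i' ← ∈-concatMap⁻′ _ (rangeDesc (suc i) (suc j ∸ i)) r∈new
    with y , _ , refl ← ∈-map⁻ _ r∈i'
    with _ , above ← chainsAbove-sound n f i (suc j) (suc-f+j e) r∈old
    with _ , suc-j<suc-j ← All.head (++⁻ʳ y above) = <-irrefl refl suc-j<suc-j

map-∸-rangeDesc : ∀ k lo m → map (λ x → m + (lo + k) ∸ x) (rangeDesc lo k) ≡ range (suc m) k
map-∸-rangeDesc zero lo m = refl
map-∸-rangeDesc (suc k) lo m = cong₂ _∷_ head≡ (trans (map-cong (λ x → cong (_∸ x) bump) (rangeDesc lo k)) (map-∸-rangeDesc k lo (suc m)))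
  where
  bump : m + (lo + suc k) ≡ suc m + (lo + k)
  bump = trans (cong (m +_) (+-suc lo k)) (+-suc m (lo + k))
  head≡ : m + (lo + suc k) ∸ (lo + k) ≡ suc m
  head≡ = trans (cong (_∸ (lo + k)) bump) (m+n∸n≡m (suc m) (lo + k))

sum-map-cong-∈ : ∀ {g h : ℕ → ℕ} ks → (∀ {k} → k ∈ ks → g k ≡ h k) → sum (map g ks) ≡ sum (map h ks)
sum-map-cong-∈ [] e = refl
sum-map-cong-∈ (k ∷ ks) e = cong₂ _+_ (e (here refl)) (sum-map-cong-∈ ks (λ k∈ → e (there k∈)))

-- Reflecting blocks (i , j) ↦ (n + 1 − j , n + 1 − i) turns these chains into those counted by chainCount.
chainsAbove-count : ∀ n f i j → f + j ≡ n → i ≤ j → length (chainsAbove f i j) ≡ chainCount f (suc n ∸ i)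
chainsAbove-count n zero i j e i≤j = refl
chainsAbove-count n (suc f) i j e i≤j = begin
  length (chainsAbove f i (suc j) ++ concatMap new (rangeDesc (suc i) k))
    ≡⟨ length-++ (chainsAbove f i (suc j)) ⟩
  length (chainsAbove f i (suc j)) + length (concatMap new (rangeDesc (suc i) k))
    ≡⟨ cong₂ _+_ (chainsAbove-count n f i (suc j) (suc-f+j e) (m≤n⇒m≤1+n i≤j)) (length-concatMap new (rangeDesc (suc i) k)) ⟩
  chainCount f (suc n ∸ i) + sum (map (λ i' → length (new i')) (rangeDesc (suc i) k))
    ≡⟨ cong (chainCount f (suc n ∸ i) +_) (sum-map-cong-∈ (rangeDesc (suc i) k) new-count) ⟩
  chainCount f (suc n ∸ i) + sum (map (λ i' → chainCount f (suc n ∸ i')) (rangeDesc (suc i) k))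
    ≡⟨ cong (λ t → chainCount f (suc n ∸ i) + sum t) (map-∘ (rangeDesc (suc i) k)) ⟩
  chainCount f (suc n ∸ i) + sum (map (chainCount f) (map (suc n ∸_) (rangeDesc (suc i) k)))
    ≡⟨ cong (λ t → chainCount f (suc n ∸ i) + sum (map (chainCount f) t)) reflected ⟩
  chainCount f (suc n ∸ i) + sum (map (chainCount f) (range (suc f) k))
    ≡⟨ cong (λ t → chainCount f (suc n ∸ i) + sum (map (chainCount f) (range (suc f) t))) width ⟨
  chainCount f (suc n ∸ i) + sum (map (chainCount f) (range (suc f) (suc n ∸ i ∸ suc f)))
    ≡⟨ chainCount-suc f (suc n ∸ i) ⟨
  chainCount (suc f) (suc n ∸ i) ∎
  where
  open ≡-Reasoning
  new : ℕ → List (List (ℕ × ℕ))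
  new i' = map (_∷ʳ (i' , suc j)) (chainsAbove f i' (suc j))
  k : ℕ
  k = suc j ∸ i
  i≤suc-j : i ≤ suc j
  i≤suc-j = m≤n⇒m≤1+n i≤j
  top : f + (suc i + k) ≡ suc n
  top = trans (cong (λ t → f + suc t) (m+[n∸m]≡n i≤suc-j)) (trans (+-suc f (suc j)) (cong suc (suc-f+j e)))
  new-count : ∀ {i'} → i' ∈ rangeDesc (suc i) k → length (new i') ≡ chainCount f (suc n ∸ i')
  new-count {i'} i'∈ with i<i' , i'< ← ∈-rangeDesc⁻ (suc i) k i'∈ =
    trans (length-map (_∷ʳ (i' , suc j)) (chainsAbove f i' (suc j)))
      (chainsAbove-count n f i' (suc j) (suc-f+j e) (≤-pred (<+∸⇒< (suc i) (suc (suc j)) i<i' i'<)))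
  reflected : map (λ i' → suc n ∸ i') (rangeDesc (suc i) k) ≡ range (suc f) k
  reflected = trans (map-cong (λ x → cong (_∸ x) (sym top)) (rangeDesc (suc i) k)) (map-∸-rangeDesc k (suc i) f)
  width : suc n ∸ i ∸ suc f ≡ k
  width = begin
    suc n ∸ i ∸ suc f                ≡⟨ cong (λ t → t ∸ i ∸ suc f) (trans (+-suc (suc f) j) (cong suc e)) ⟨
    suc f + suc j ∸ i ∸ suc f        ≡⟨ cong (_∸ suc f) (+-∸-assoc (suc f) i≤suc-j) ⟩
    suc f + k ∸ suc f                ≡⟨ m+n∸m≡n (suc f) k ⟩
    k                                ∎

evalBlocks : ℕ → List (ℕ × ℕ) → List ℕ
evalBlocks n bs = eval n (blocksWord bs)

decreasing⇒chain : ∀ n i j bs → All (BlockOK n) bs → Decreasing ((i , j) ∷ bs) → Chain i j bs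
decreasing⇒chain n i j [] _ _ = []
decreasing⇒chain n i j ((i' , j') ∷ bs) ((1≤i' , i'≤j' , _) ∷ ok) (i'<i , j'<j , dec) =
  cons 1≤i' i'≤j' i'<i j'<j (decreasing⇒chain n i' j' bs ok dec)

canonical⇒chain : ∀ n bs → All (BlockOK n) bs → Decreasing bs → Chain (suc n) (suc n) bs
canonical⇒chain n [] _ _ = []
canonical⇒chain n ((i , j) ∷ bs) ((1≤i , i≤j , j≤n) ∷ ok) dec =
  cons 1≤i i≤j (s≤s (≤-trans i≤j j≤n)) (s≤s j≤n) (decreasing⇒chain n i j bs ok dec)

chain⇒canonical : ∀ n {I J} bs → J ≤ suc n → Chain I J bs → All (BlockOK n) bs × Decreasing bs
chain⇒canonical n [] _ [] = [] , tt
chain⇒canonical n ((i , j) ∷ bs) J≤ (cons 1≤i i≤j _ j<J ch)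
  with ok , dec ← chain⇒canonical n bs (≤-trans (n≤1+n j) (≤-trans j<J J≤)) ch =
  (1≤i , i≤j , ≤-pred (≤-trans j<J J≤)) ∷ ok , head-decreasing ch dec
  where
  head-decreasing : ∀ {i j bs} → Chain i j bs → Decreasing bs → Decreasing ((i , j) ∷ bs)
  head-decreasing [] _ = tt
  head-decreasing (cons _ _ i'<i j'<j _) dec = i'<i , j'<j , dec

chain⇒isCanonicalForm : ∀ n bs → (∃[ b ] ∃[ bs' ] bs ≡ b ∷ bs') → Chain (suc n) (suc n) bs →
  IsCanonicalForm n bs (evalBlocks n bs)
chain⇒isCanonicalForm n bs nonempty ch with ok , dec ← chain⇒canonical n bs ≤-refl ch = nonempty , ok , dec , refl

chain⇒fullyCommutative : ∀ n bs → Chain (suc n) (suc n) bs → IsFC n (evalBlocks n bs)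
chain⇒fullyCommutative n bs ch =
  (blocksWord bs , All.map (λ { (1≤k , k<) → 1≤k , ≤-pred k< }) (chain-letters ch) , refl) ,
  avoids321⇒fullyCommutative n _ (evalBlocks n bs) refl
    (chain-avoids321 (idPerm n) (chainInvariant-idPerm n) ch) (isPerm-eval n (blocksWord bs))

chain-evalBlocks-injective : ∀ n {bs bs'} → Chain (suc n) (suc n) bs → Chain (suc n) (suc n) bs' →
  evalBlocks n bs ≡ evalBlocks n bs' → bs ≡ bs'
chain-evalBlocks-injective n = chain-applyBlocks-injective (idPerm n) (upTo⁺ (suc n))
  (≤-reflexive (sym (length-applyUpTo (λ t → t) (suc n))))

unique-map-injectiveOn : ∀ {X Y : Set} {P : X → Set} (g : X → Y) (xs : List X) → Unique xs → All P xs →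
  (∀ {x y} → P x → P y → g x ≡ g y → x ≡ y) → Unique (map g xs)
unique-map-injectiveOn g [] _ _ _ = []
unique-map-injectiveOn {P = P} g (x ∷ xs) (x∉ ∷ u) (px ∷ ps) inj = head-fresh xs x∉ ps ∷ unique-map-injectiveOn g xs u ps inj
  where
  head-fresh : ∀ ys → All (x ≢_) ys → All P ys → All (g x ≢_) (map g ys)
  head-fresh [] _ _ = []
  head-fresh (y ∷ ys) (x≢y ∷ x∉ys) (py ∷ pys) = (λ e → x≢y (inj px py e)) ∷ head-fresh ys x∉ys pys

hasCount-canonical : ∀ n {P : List ℕ → Set} (cs : List (List (ℕ × ℕ))) → Unique cs →
  (∀ {bs} → bs ∈ cs → Chain (suc n) (suc n) bs × P (evalBlocks n bs)) →
  (∀ {p} → P p → ∃[ bs ] (bs ∈ cs × evalBlocks n bs ≡ p)) → HasCount P (length cs)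
hasCount-canonical n {P} cs ucs sound complete =
  map (evalBlocks n) cs ,
  unique-map-injectiveOn (evalBlocks n) cs ucs (All.tabulate (λ bs∈ → proj₁ (sound bs∈))) (chain-evalBlocks-injective n) ,
  (λ p → to p , from p) ,
  length-map (evalBlocks n) cs
  where
  to : ∀ p → p ∈ map (evalBlocks n) cs → P p
  to p p∈ with bs , bs∈ , p≡ ← ∈-map⁻ _ p∈ = subst P (sym p≡) (proj₂ (sound bs∈))
  from : ∀ p → P p → p ∈ map (evalBlocks n) cs
  from p Pp with bs , bs∈ , bs↦p ← complete Pp = subst (_∈ _) bs↦p (∈-map⁺ _ bs∈)

firstBlock-hasCount : ∀ n i j → 1 ≤ i → i ≤ j → j ≤ n → HasCount (FCFirstBlock n i j) (chainCount (i ∸ 1) j)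
firstBlock-hasCount n (suc a) j _ i≤j j≤n = subst (HasCount _) (length-map _ (chainsBelow a j))
  (hasCount-canonical n (map ((suc a , j) ∷_) (chainsBelow a j)) (Unique-map⁺ ∷-injectiveʳ (chainsBelow-unique a j)) sound complete)
  where
  sound : ∀ {bs} → bs ∈ map ((suc a , j) ∷_) (chainsBelow a j) → Chain (suc n) (suc n) bs × FCFirstBlock n (suc a) j (evalBlocks n bs)
  sound bs∈ with r , r∈ , refl ← ∈-map⁻ _ bs∈ =
    ch , chain⇒fullyCommutative n _ ch , r , chain⇒isCanonicalForm n _ (_ , _ , refl) ch
    where ch = cons (s≤s z≤n) i≤j (s≤s (≤-trans i≤j j≤n)) (s≤s j≤n) (chainsBelow-sound a j r∈)
  complete : ∀ {p} → FCFirstBlock n (suc a) j p → ∃[ bs ] (bs ∈ map ((suc a , j) ∷_) (chainsBelow a j) × evalBlocks n bs ≡ p)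
  complete (_ , rest , _ , ok , dec , ev) with cons _ _ _ _ ch ← canonical⇒chain n _ ok dec =
    _ , ∈-map⁺ _ (chainsBelow-complete a j ch) , ev

lastBlock-hasCount : ∀ n i j → 1 ≤ i → i ≤ j → j ≤ n → HasCount (FCLastBlock n i j) (chainCount (n ∸ j) (suc n ∸ i))
lastBlock-hasCount n i j 1≤i i≤j j≤n =
  subst (HasCount _) (trans (length-map _ (chainsAbove (n ∸ j) i j)) (chainsAbove-count n (n ∸ j) i j f+j≡n i≤j))
  (hasCount-canonical n (map (_∷ʳ (i , j)) (chainsAbove (n ∸ j) i j))
    (Unique-map⁺ (λ {x} {y} → ∷ʳ-injectiveˡ x y) (chainsAbove-unique n (n ∸ j) i j f+j≡n)) sound complete)
  where
  f+j≡n : n ∸ j + j ≡ n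
  f+j≡n = m∸n+n≡m j≤n
  sound : ∀ {bs} → bs ∈ map (_∷ʳ (i , j)) (chainsAbove (n ∸ j) i j) → Chain (suc n) (suc n) bs × FCLastBlock n i j (evalBlocks n bs)
  sound bs∈ with r , r∈ , refl ← ∈-map⁻ _ bs∈ with ch , above ← chainsAbove-sound n (n ∸ j) i j f+j≡n r∈ =
    ch' , chain⇒fullyCommutative n _ ch' , r , chain⇒isCanonicalForm n _ (∷ʳ-nonempty r) ch'
    where
    ch' = chain-∷ʳ⁺ ch above 1≤i i≤j (s≤s (≤-trans i≤j j≤n)) (s≤s j≤n)
    ∷ʳ-nonempty : ∀ (r : List (ℕ × ℕ)) → ∃[ b ] ∃[ bs ] (r ∷ʳ (i , j) ≡ b ∷ bs)
    ∷ʳ-nonempty [] = _ , [] , refl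
    ∷ʳ-nonempty (b ∷ r) = b , r ∷ʳ (i , j) , refl
  complete : ∀ {p} → FCLastBlock n i j p → ∃[ bs ] (bs ∈ map (_∷ʳ (i , j)) (chainsAbove (n ∸ j) i j) × evalBlocks n bs ≡ p)
  complete (_ , rest , _ , ok , dec , ev) with ch , above , _ ← chain-∷ʳ⁻ rest (canonical⇒chain n _ ok dec) =
    _ , ∈-map⁺ _ (chainsAbove-complete n (n ∸ j) i j f+j≡n ch above) , ev

firstBlock-formula : ∀ i j → 1 ≤ i → i ≤ j → (j + 1) * chainCount (i ∸ 1) j ≡ (j + 2 ∸ i) * ((j + i ∸ 1) C j)
firstBlock-formula (suc a) j _ i≤j = begin
  (j + 1) * chainCount a j               ≡⟨ cong (_* chainCount a j) (+-comm j 1) ⟩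
  suc j * chainCount a j                 ≡⟨ chainCount-formula a j (≤-trans (n≤1+n a) i≤j) ⟩
  (suc j ∸ a) * ((a + j) C j)            ≡⟨ cong₂ (λ s t → (s ∸ suc a) * (t C j)) (+-comm 2 j) (trans (+-comm a j) (sym (cong (_∸ 1) (+-suc j a)))) ⟩
  (j + 2 ∸ suc a) * ((j + suc a ∸ 1) C j) ∎
  where open ≡-Reasoning

≡+⇒∸≡ : ∀ i {x y} → x ≡ i + y → x ∸ i ≡ y
≡+⇒∸≡ i {y = y} refl = m+n∸m≡n i y

lastBlock-formula : ∀ n i j → i ≤ j → j ≤ n →
  (n + 2 ∸ i) * chainCount (n ∸ j) (suc n ∸ i) ≡ (j + 2 ∸ i) * ((2 * n + 1 ∸ j ∸ i) C (n ∸ j))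
lastBlock-formula n i j i≤j j≤n with q , refl ← m≤n⇒∃[o]m+o≡n i≤j with p , refl ← m≤n⇒∃[o]m+o≡n j≤n = begin
  (i + q + p + 2 ∸ i) * chainCount (i + q + p ∸ (i + q)) (suc (i + q + p) ∸ i)
    ≡⟨ cong₂ (λ s b → s * chainCount (i + q + p ∸ (i + q)) b) (≡+⇒∸≡ i (e₁ i q p)) (≡+⇒∸≡ i (e₂ i q p)) ⟩
  suc (suc (q + p)) * chainCount (i + q + p ∸ (i + q)) (suc (q + p))
    ≡⟨ cong (λ a → suc (suc (q + p)) * chainCount a (suc (q + p))) (m+n∸m≡n (i + q) p) ⟩
  suc (suc (q + p)) * chainCount p (suc (q + p))
    ≡⟨ chainCount-formula p (suc (q + p)) (≤-trans (m≤n+m p q) (n≤1+n _)) ⟩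
  (suc (suc (q + p)) ∸ p) * ((p + suc (q + p)) C suc (q + p))
    ≡⟨ cong₂ _*_ (≡+⇒∸≡ p (e₃ q p)) (trans (nCk≡nC[n∸k] (m≤n+m (suc (q + p)) p)) (cong ((p + suc (q + p)) C_) (m+n∸n≡m p (suc (q + p))))) ⟩
  suc (suc q) * ((p + suc (q + p)) C p)
    ≡⟨ cong₂ (λ s t → s * (t C p)) (≡+⇒∸≡ i (e₄ i q)) (trans (cong (_∸ i) (≡+⇒∸≡ (i + q) (e₅ i q p))) (≡+⇒∸≡ i refl)) ⟨
  (i + q + 2 ∸ i) * ((2 * (i + q + p) + 1 ∸ (i + q) ∸ i) C p)
    ≡⟨ cong (λ a → (i + q + 2 ∸ i) * ((2 * (i + q + p) + 1 ∸ (i + q) ∸ i) C a)) (m+n∸m≡n (i + q) p) ⟨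
  (i + q + 2 ∸ i) * ((2 * (i + q + p) + 1 ∸ (i + q) ∸ i) C (i + q + p ∸ (i + q))) ∎
  where
  open ≡-Reasoning
  e₁ : ∀ i q p → i + q + p + 2 ≡ i + suc (suc (q + p))
  e₁ = solve-∀
  e₂ : ∀ i q p → suc (i + q + p) ≡ i + suc (q + p)
  e₂ = solve-∀
  e₃ : ∀ q p → suc (suc (q + p)) ≡ p + suc (suc q)
  e₃ = solve-∀
  e₄ : ∀ i q → i + q + 2 ≡ i + suc (suc q)
  e₄ = solve-∀
  e₅ : ∀ i q p → 2 * (i + q + p) + 1 ≡ i + q + (i + (p + suc (q + p)))
  e₅ = solve-∀

mainTheorem11 : (n : ℕ) →
    (∀ i j → 1 ≤ i → i ≤ j → j ≤ n →
      ∃[ N ] (HasCount (FCFirstBlock n i j) N ×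
        (j + 1) * N ≡ (j + 2 ∸ i) * ((j + i ∸ 1) C j)))
    ×
    (∀ i j → 1 ≤ i → i ≤ j → j ≤ n →
      ∃[ N ] (HasCount (FCLastBlock n i j) N ×
        (n + 2 ∸ i) * N ≡ (j + 2 ∸ i) * ((2 * n + 1 ∸ j ∸ i) C (n ∸ j))))
mainTheorem11 n =
  (λ i j 1≤i i≤j j≤n → chainCount (i ∸ 1) j ,
     firstBlock-hasCount n i j 1≤i i≤j j≤n , firstBlock-formula i j 1≤i i≤j) ,
  (λ i j 1≤i i≤j j≤n → chainCount (n ∸ j) (suc n ∸ i) ,
     lastBlock-hasCount n i j 1≤i i≤j j≤n , lastBlock-formula n i j i≤j j≤n)
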